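{- Let $p_1>3$ be a prime such that $p_2=2p_1-1$ is also prime, and let $n=p_1p_2$. Then exactly $\varphi(n)/4$ elements of $\mathbb{Z}_n^*$ are Euler liars for $n$, and among these Euler liars the Jacobi symbol $\left(\frac{a}{n}\right)$ takes the values $1$ and $-1$ equally often.
   Context: For an odd composite $n$, an element $a\in\mathbb{Z}_n^*$ is an Euler liar if $\left(\frac{a}{n}\right)\equiv a^{(n-1)/2}\pmod n$, where $\left(\frac{a}{n}\right)$ denotes the Jacobi symbol. -}

module Defs where

open import Data.Nat as ℕ using (ℕ; zero; suc; _+_; _*_; _∸_; _^_; _<_; _≤_)
open import Data.Nat.DivMod using (_%_; _/_)
open import Data.Nat.Divisibility using (_∣?_)
open import Data.Nat.Coprimality using (Coprime; coprime?)
open import Data.Integer as ℤ using (ℤ; +_; -_)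
open import Data.List using (List; filter; upTo; length; map)
open import Data.Bool.ListAction using (any)
open import Data.Bool using (Bool; true; false; if_then_else_)
open import Relation.Nullary.Decidable using (⌊_⌋; Dec)
open import Data.Integer.DivMod using (_%ℕ_)
open import Relation.Binary.PropositionalEquality using (_≡_)

isSquareMod : ℕ → (m : ℕ) → .{{ℕ.NonZero m}} → Bool
isSquareMod a m = any (λ x → ⌊ (x * x) % m ℕ.≟ a % m ⌋) (upTo m)

legendre : ℤ → ℕ → ℤ
legendre a zero = + 0
legendre a (suc q) =
  let r = a %ℕ suc q in
  if ⌊ r ℕ.≟ 0 ⌋ then + 0
  else (if isSquareMod r (suc q) then + 1 else - (+ 1))

-- k such that 2+k is the least divisor ≥ 2+d of m (fuel-bounded search);
-- for m ≥ 2 and enough fuel, 2 + least-divisor-offset is the least prime factor of m.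
lpfOffset : ℕ → ℕ → ℕ → ℕ
lpfOffset zero d m = d
lpfOffset (suc fuel) d m =
  if ⌊ (2 + d) ∣? m ⌋ then d else lpfOffset fuel (suc d) m

lpf : ℕ → ℕ
lpf m = 2 + lpfOffset m 0 m

-- Jacobi symbol (a/n) for odd n ≥ 1: the product of the Legendre symbols (a/p)
-- over the prime factorisation of n, counted with multiplicity; (a/1) = 1.
jacobiAux : ℕ → ℤ → ℕ → ℤ
jacobiAux zero a n = + 1
jacobiAux (suc fuel) a n =
  if ⌊ n ℕ.≤? 1 ⌋ then + 1
  else legendre a (lpf n) ℤ.* jacobiAux fuel a (n / (2 + lpfOffset n 0 n))

jacobi : ℤ → ℕ → ℤ
jacobi a n = jacobiAux n a n

φ : ℕ → ℕ
φ n = length (filter (λ a → coprime? a n) (map suc (upTo n)))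

-- ℤ_n^* represented as {a ∈ ℕ : 1 ≤ a < n, gcd(a,n) = 1}.
units : ℕ → List ℕ
units n = filter (λ a → coprime? a n) (map suc (upTo (n ∸ 1)))

EulerLiar : (n : ℕ) → .{{ℕ.NonZero n}} → ℕ → Set
EulerLiar n a = jacobi (+ a) n %ℕ n ≡ (a ^ ((n ∸ 1) / 2)) % n

eulerLiar? : (n : ℕ) → .{{_ : ℕ.NonZero n}} → (a : ℕ) → Dec (EulerLiar n a)
eulerLiar? n a = jacobi (+ a) n %ℕ n ℕ.≟ (a ^ ((n ∸ 1) / 2)) % n

eulerLiars : (n : ℕ) → .{{ℕ.NonZero n}} → List ℕ
eulerLiars n = filter (eulerLiar? n) (units n)

liarsWithJacobi : (n : ℕ) → .{{ℕ.NonZero n}} → ℤ → ℕ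
liarsWithJacobi n s = length (filter (λ a → jacobi (+ a) n ℤ.≟ s) (eulerLiars n))

module Submission where

-- Write q = p₁ = 2k + 1 and r = p₂ = 4k + 1, so that (n − 1)/2 = k + 2kq. For a unit a with
-- residues u mod q and v mod r, Euler's criterion gives a^((n−1)/2) ≡ (u/q) mod q and
-- a^((n−1)/2) ≡ v^k (v/r) mod r, while (a/n) = (u/q) (v/r). Comparing the two sides modulo q and
-- modulo r, a is an Euler liar exactly when v is a square mod r and v^k ≡ (u/q) mod r.
-- The nonzero squares mod r are the s² with 1 ≤ s ≤ 2k, and (s²)^k ≡ (s/r); as −1 is a square
-- mod r, the reflection s ↦ r − s shows that (s/r) = 1 for exactly k of these s. So every one of
-- the 2k units u mod q admits exactly k residues v: there are 2k² = φ(n)/4 liars, on which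
-- (a/n) = (u/q) takes each value k² times.
-- Euler's criterion itself comes from Wilson's argument: pairing each unit x with a x⁻¹ in the
-- product of all units mod p. The hypothesis p₁ > 3 is only used to make p₁ odd.

open import Data.Nat using (ℕ; NonZero; suc; _*_; _+_; _<_)
open import Data.Nat.Primality using (Prime)

module Arithmetic where

  open import Data.Nat
  open import Data.Nat.DivMod
  open import Data.Nat.Properties
  open import Algebra.Properties.CommutativeSemigroup *-commutativeSemigroup
    using () renaming (interchange to *-interchange)
  open import Relation.Binary.PropositionalEquality

  [u*r+x]%r≡x : ∀ u {x} r .{{_ : NonZero r}} → x < r → (u * r + x) % r ≡ x
  [u*r+x]%r≡x u {x} r x<r = begin
    (u * r + x) % r    ≡⟨ cong (_% r) (+-comm (u * r) x) ⟩
    (x + u * r) % r    ≡⟨ [m+kn]%n≡m%n x u r ⟩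
    x % r              ≡⟨ m<n⇒m%n≡m x<r ⟩
    x                  ∎
    where open ≡-Reasoning

  [u*r+x]/r≡u : ∀ u {x} r .{{_ : NonZero r}} → x < r → (u * r + x) / r ≡ u
  [u*r+x]/r≡u u {x} r x<r = begin
    (u * r + x) / r    ≡⟨ +-distrib-/ (u * r) x remainders<r ⟩
    u * r / r + x / r  ≡⟨ cong₂ _+_ (m*n/n≡m u r) (m<n⇒m/n≡0 x<r) ⟩
    u + 0              ≡⟨ +-identityʳ u ⟩
    u                  ∎
    where
    open ≡-Reasoning
    remainders<r : (u * r) % r + x % r < r
    remainders<r = subst (_< r) (sym (cong₂ _+_ (m*n%n≡0 u r) (m<n⇒m%n≡m x<r))) x<r

  ^-distribʳ-* : ∀ a b n → (a * b) ^ n ≡ a ^ n * b ^ n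
  ^-distribʳ-* a b zero = refl
  ^-distribʳ-* a b (suc n) = trans (cong (a * b *_) (^-distribʳ-* a b n)) (*-interchange a b (a ^ n) (b ^ n))

module Counting where

  open import Data.Bool using (Bool; true; false; _∧_; not; T)
  import Data.Bool as Bool
  open import Data.Bool.Properties using (∧-identityʳ; ∧-zeroʳ)
  open import Data.Empty using (⊥-elim)
  open import Data.List using ([]; _∷_; filter; length; map; upTo; applyUpTo)
  open import Data.List.Properties using (map-upTo)
  open import Data.Nat
  open import Data.Nat.DivMod
  open import Data.Nat.Properties
  open import Algebra.Properties.CommutativeSemigroup +-commutativeSemigroup
    using () renaming (interchange to +-interchange)
  open import Data.Product using (_×_; _,_; proj₁; proj₂)
  open import Function using (_∘′_; _⇔_; Equivalence)
  open import Level using (0ℓ)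
  open import Relation.Nullary using (Dec; yes; no; contradiction)
  open import Relation.Nullary.Decidable using (⌊_⌋; _×-dec_)
  open import Relation.Unary using (Pred; Decidable)
  open import Relation.Binary.PropositionalEquality

  open Arithmetic

  toℕ : Bool → ℕ
  toℕ false = 0
  toℕ true = 1

  ⌊⌋-⇔ : ∀ {A B : Set} → A ⇔ B → (a? : Dec A) (b? : Dec B) → ⌊ a? ⌋ ≡ ⌊ b? ⌋
  ⌊⌋-⇔ _ (yes _) (yes _) = refl
  ⌊⌋-⇔ A⇔B (yes a) (no ¬b) = contradiction (Equivalence.to A⇔B a) ¬b
  ⌊⌋-⇔ A⇔B (no ¬a) (yes b) = contradiction (Equivalence.from A⇔B b) ¬a
  ⌊⌋-⇔ _ (no _) (no _) = refl

  ⌊⌋-reflects : ∀ {A : Set} {b} → A ⇔ T b → (a? : Dec A) → ⌊ a? ⌋ ≡ b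
  ⌊⌋-reflects {b = true} _ (yes _) = refl
  ⌊⌋-reflects {b = true} A⇔T (no ¬a) = contradiction (Equivalence.from A⇔T _) ¬a
  ⌊⌋-reflects {b = false} A⇔T (yes a) = ⊥-elim (Equivalence.to A⇔T a)
  ⌊⌋-reflects {b = false} _ (no _) = refl

  ⌊×-dec⌋ : ∀ {A B : Set} (a? : Dec A) (b? : Dec B) → ⌊ a? ×-dec b? ⌋ ≡ ⌊ a? ⌋ ∧ ⌊ b? ⌋
  ⌊×-dec⌋ (yes _) (yes _) = refl
  ⌊×-dec⌋ (yes _) (no _) = refl
  ⌊×-dec⌋ (no _) _ = refl

  ⌊≟true⌋ : ∀ b → ⌊ b Bool.≟ true ⌋ ≡ b
  ⌊≟true⌋ false = refl
  ⌊≟true⌋ true = refl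

  ⌊≟false⌋ : ∀ b → ⌊ b Bool.≟ false ⌋ ≡ not b
  ⌊≟false⌋ false = refl
  ⌊≟false⌋ true = refl

  count : (ℕ → Bool) → ℕ → ℕ
  count f zero = 0
  count f (suc m) = count f m + toℕ (f m)

  count-cong : ∀ {f g} m → (∀ x → x < m → f x ≡ g x) → count f m ≡ count g m
  count-cong zero f≗g = refl
  count-cong (suc m) f≗g =
    cong₂ _+_ (count-cong m (λ x x<m → f≗g x (m<n⇒m<1+n x<m))) (cong toℕ (f≗g m ≤-refl))

  count-true : ∀ m → count (λ _ → true) m ≡ m
  count-true zero = refl
  count-true (suc m) = trans (cong (_+ 1) (count-true m)) (+-comm m 1)

  count-false : ∀ m → count (λ _ → false) m ≡ 0
  count-false zero = refl
  count-false (suc m) = trans (+-identityʳ _) (count-false m)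

  count-const-∧ : ∀ b (f : ℕ → Bool) m → count (λ x → b ∧ f x) m ≡ toℕ b * count f m
  count-const-∧ false f m = count-false m
  count-const-∧ true f m = sym (+-identityʳ (count f m))

  count-∧ : ∀ (f g : ℕ → Bool) m →
    count f m ≡ count (λ x → f x ∧ g x) m + count (λ x → f x ∧ not (g x)) m
  count-∧ f g zero = refl
  count-∧ f g (suc m) =
    trans (cong₂ _+_ (count-∧ f g m) (split (f m) (g m)))
          (+-interchange (count F m) (count F′ m) (toℕ (F m)) (toℕ (F′ m)))
    where
    F F′ : ℕ → Bool
    F x = f x ∧ g x
    F′ x = f x ∧ not (g x)
    split : ∀ a b → toℕ a ≡ toℕ (a ∧ b) + toℕ (a ∧ not b)
    split false _ = refl
    split true false = refl
    split true true = refl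

  count-not : ∀ (f : ℕ → Bool) m → count f m + count (λ x → not (f x)) m ≡ m
  count-not f m = trans (sym (count-∧ (λ _ → true) f m)) (count-true m)

  count-suc : ∀ (f : ℕ → Bool) m → count f (suc m) ≡ toℕ (f 0) + count (λ x → f (suc x)) m
  count-suc f zero = +-comm 0 (toℕ (f 0))
  count-suc f (suc m) = trans (cong (_+ toℕ (f (suc m))) (count-suc f m)) (+-assoc (toℕ (f 0)) _ _)

  count-from-1 : ∀ (f : ℕ → Bool) m → f 0 ≡ false → count (λ x → f (suc x)) m ≡ count f (suc m)
  count-from-1 f m f0≡false = sym (trans (count-suc f m) (cong (λ b → toℕ b + count (λ x → f (suc x)) m) f0≡false))

  count-positive : ∀ m → count (0 <ᵇ_) (suc m) ≡ m
  count-positive m = trans (count-suc (0 <ᵇ_) m) (count-true m)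

  count-+ : ∀ (f : ℕ → Bool) a b → count f (a + b) ≡ count f a + count (λ x → f (a + x)) b
  count-+ f a zero = trans (cong (count f) (+-identityʳ a)) (sym (+-identityʳ _))
  count-+ f a (suc b) = begin
      count f (a + suc b)                                          ≡⟨ cong (count f) (+-suc a b) ⟩
      count f (a + b) + toℕ (f (a + b))                            ≡⟨ cong (_+ toℕ (f (a + b))) (count-+ f a b) ⟩
      count f a + count (λ x → f (a + x)) b + toℕ (f (a + b))      ≡⟨ +-assoc (count f a) _ _ ⟩
      count f a + count (λ x → f (a + x)) (suc b)                  ∎
    where open ≡-Reasoning

  private
    without : (ℕ → Bool) → ℕ → ℕ → Bool
    without f c x = f x ∧ not ⌊ x ≟ c ⌋

    without-≢ : ∀ f {c x} → x ≢ c → without f c x ≡ f x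
    without-≢ f {c} {x} x≢c with x ≟ c
    ... | yes x≡c = contradiction x≡c x≢c
    ... | no _ = ∧-identityʳ (f x)

    count-without : ∀ f {c} m → c < m → T (f c) → count f m ≡ suc (count (without f c) m)
    count-without f {c} (suc m) c<1+m fc with m ≟ c
    ... | yes refl = begin
        count f m + toℕ (f m)               ≡⟨ cong (count f m +_) (T⇒≡true fc) ⟩
        count f m + 1                       ≡⟨ +-comm _ 1 ⟩
        suc (count f m)                     ≡⟨ cong suc (count-cong m (λ x x<m → sym (without-≢ f (<⇒≢ x<m)))) ⟩
        suc (count (without f m) m)         ≡⟨ cong suc (+-identityʳ _) ⟨
        suc (count (without f m) m + 0)     ≡⟨ cong (λ b → suc (count (without f m) m + toℕ b)) (∧-zeroʳ (f m)) ⟨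
        suc (count (without f m) m + toℕ (f m ∧ false)) ∎
      where
      open ≡-Reasoning
      T⇒≡true : ∀ {b} → T b → toℕ b ≡ 1
      T⇒≡true {true} _ = refl
    ... | no m≢c = cong₂ _+_ (count-without f m c<m fc) (cong toℕ (sym (∧-identityʳ (f m))))
      where
      c<m : c < m
      c<m = ≤∧≢⇒< (≤-pred c<1+m) (m≢c ∘′ sym)

  count-injection : ∀ (f g : ℕ → Bool) (h : ℕ → ℕ) m m′ →
    (∀ x → x < m → T (f x) → h x < m′ × T (g (h x))) →
    (∀ x y → x < m → y < m → T (f x) → T (f y) → h x ≡ h y → x ≡ y) →
    count f m ≤ count g m′
  count-injection f g h zero m′ maps inj = z≤n
  count-injection f g h (suc m) m′ maps inj with f m in fm
  ... | false = subst (_≤ count g m′) (sym (+-identityʳ _)) (count-injection f g h m m′ maps′ inj′)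
    where
    maps′ : ∀ x → x < m → T (f x) → h x < m′ × T (g (h x))
    maps′ x x<m = maps x (m<n⇒m<1+n x<m)
    inj′ : ∀ x y → x < m → y < m → T (f x) → T (f y) → h x ≡ h y → x ≡ y
    inj′ x y x<m y<m = inj x y (m<n⇒m<1+n x<m) (m<n⇒m<1+n y<m)
  ... | true = begin
      count f m + 1                   ≡⟨ +-comm _ 1 ⟩
      suc (count f m)                 ≤⟨ s≤s (count-injection f (without g (h m)) h m m′ maps′ inj′) ⟩
      suc (count (without g (h m)) m′) ≡⟨ count-without g m′ hm<m′ ghm ⟨
      count g m′                      ∎
    where
    open ≤-Reasoning
    fm′ : T (f m)
    fm′ = subst T (sym fm) _
    hm<m′ = proj₁ (maps m ≤-refl fm′)
    ghm = proj₂ (maps m ≤-refl fm′)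
    inj′ : ∀ x y → x < m → y < m → T (f x) → T (f y) → h x ≡ h y → x ≡ y
    inj′ x y x<m y<m = inj x y (m<n⇒m<1+n x<m) (m<n⇒m<1+n y<m)
    maps′ : ∀ x → x < m → T (f x) → h x < m′ × T (without g (h m) (h x))
    maps′ x x<m fx = proj₁ hx , subst T (sym (without-≢ g hx≢hm)) (proj₂ hx)
      where
      hx = maps x (m<n⇒m<1+n x<m) fx
      hx≢hm : h x ≢ h m
      hx≢hm e = <⇒≢ x<m (inj x m (m<n⇒m<1+n x<m) ≤-refl fx fm′ e)

  count-permutation : ∀ (f g : ℕ → Bool) (h : ℕ → ℕ) m →
    (∀ x → x < m → h x < m) →
    (∀ x y → x < m → y < m → h x ≡ h y → x ≡ y) →
    (∀ x → x < m → f x ≡ g (h x)) →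
    count f m ≡ count g m
  count-permutation f g h m h<m inj f≡g∘h = ≤-antisym f≤g g≤f
    where
    f≤g : count f m ≤ count g m
    f≤g = count-injection f g h m m
      (λ x x<m fx → h<m x x<m , subst T (f≡g∘h x x<m) fx)
      (λ x y x<m y<m _ _ → inj x y x<m y<m)
    ¬f≤¬g : count (λ x → not (f x)) m ≤ count (λ x → not (g x)) m
    ¬f≤¬g = count-injection _ _ h m m
      (λ x x<m ¬fx → h<m x x<m , subst T (cong not (f≡g∘h x x<m)) ¬fx)
      (λ x y x<m y<m _ _ → inj x y x<m y<m)
    g≤f : count g m ≤ count f m
    g≤f = +-cancelʳ-≤ (count (λ x → not (g x)) m) _ _ (begin
      count g m + count (λ x → not (g x)) m   ≡⟨ count-not g m ⟩
      m                                       ≡⟨ count-not f m ⟨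
      count f m + count (λ x → not (f x)) m   ≤⟨ +-monoʳ-≤ (count f m) ¬f≤¬g ⟩
      count f m + count (λ x → not (g x)) m   ∎)
      where open ≤-Reasoning

  count-inverse : ∀ (f g : ℕ → Bool) (h h′ : ℕ → ℕ) m m′ →
    (∀ x → x < m → T (f x) → h x < m′ × T (g (h x)) × h′ (h x) ≡ x) →
    (∀ y → y < m′ → T (g y) → h′ y < m × T (f (h′ y)) × h (h′ y) ≡ y) →
    count f m ≡ count g m′
  count-inverse f g h h′ m m′ to from = ≤-antisym
    (count-injection f g h m m′ (λ x x<m fx → let (hx<m′ , ghx , _) = to x x<m fx in hx<m′ , ghx)
       (λ x y x<m y<m fx fy hx≡hy → begin
          x          ≡⟨ proj₂ (proj₂ (to x x<m fx)) ⟨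
          h′ (h x)   ≡⟨ cong h′ hx≡hy ⟩
          h′ (h y)   ≡⟨ proj₂ (proj₂ (to y y<m fy)) ⟩
          y          ∎))
    (count-injection g f h′ m′ m (λ y y<m′ gy → let (h′y<m , fh′y , _) = from y y<m′ gy in h′y<m , fh′y)
       (λ x y x<m′ y<m′ gx gy h′x≡h′y → begin
          x          ≡⟨ proj₂ (proj₂ (from x x<m′ gx)) ⟨
          h (h′ x)   ≡⟨ cong h h′x≡h′y ⟩
          h (h′ y)   ≡⟨ proj₂ (proj₂ (from y y<m′ gy)) ⟩
          y          ∎))
    where open ≡-Reasoning

  count-rows : ∀ (C : ℕ → ℕ → Bool) (g : ℕ → Bool) K q r .{{_ : NonZero r}} →
    (∀ u → u < q → count (C u) r ≡ toℕ (g u) * K) →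
    count (λ a → C (a / r) (a % r)) (q * r) ≡ count g q * K
  count-rows C g K zero r rows = refl
  count-rows C g K (suc q) r rows = begin
      count F (r + q * r)                          ≡⟨ cong (count F) (+-comm r (q * r)) ⟩
      count F (q * r + r)                          ≡⟨ count-+ F (q * r) r ⟩
      count F (q * r) + count (λ x → F (q * r + x)) r
        ≡⟨ cong₂ _+_ (count-rows C g K q r (λ u u<q → rows u (m<n⇒m<1+n u<q))) (count-cong r lastRow) ⟩
      count g q * K + count (C q) r                ≡⟨ cong (count g q * K +_) (rows q ≤-refl) ⟩
      count g q * K + toℕ (g q) * K                ≡⟨ *-distribʳ-+ K (count g q) (toℕ (g q)) ⟨
      count g (suc q) * K                          ∎
    where
    open ≡-Reasoning
    F : ℕ → Bool
    F a = C (a / r) (a % r)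
    lastRow : ∀ x → x < r → F (q * r + x) ≡ C q x
    lastRow x x<r = cong₂ C ([u*r+x]/r≡u q r x<r) ([u*r+x]%r≡x q r x<r)

  length-filter-∷ : ∀ {P : Pred ℕ 0ℓ} (P? : Decidable P) x xs →
    length (filter P? (x ∷ xs)) ≡ toℕ ⌊ P? x ⌋ + length (filter P? xs)
  length-filter-∷ P? x xs with P? x
  ... | yes _ = refl
  ... | no _ = refl

  length-filter-applyUpTo : ∀ {P : Pred ℕ 0ℓ} (P? : Decidable P) (g : ℕ → ℕ) m →
    length (filter P? (applyUpTo g m)) ≡ count (λ x → ⌊ P? (g x) ⌋) m
  length-filter-applyUpTo P? g zero = refl
  length-filter-applyUpTo P? g (suc m) = begin
    length (filter P? (g 0 ∷ applyUpTo (λ x → g (suc x)) m))          ≡⟨ length-filter-∷ P? (g 0) _ ⟩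
    toℕ ⌊ P? (g 0) ⌋ + length (filter P? (applyUpTo (λ x → g (suc x)) m))
      ≡⟨ cong (toℕ ⌊ P? (g 0) ⌋ +_) (length-filter-applyUpTo P? (λ x → g (suc x)) m) ⟩
    toℕ ⌊ P? (g 0) ⌋ + count (λ x → ⌊ P? (g (suc x)) ⌋) m              ≡⟨ count-suc _ m ⟨
    count (λ x → ⌊ P? (g x) ⌋) (suc m)                                ∎
    where open ≡-Reasoning

  filter-filter : ∀ {P Q : Pred ℕ 0ℓ} (P? : Decidable P) (Q? : Decidable Q) xs →
    filter P? (filter Q? xs) ≡ filter (λ x → Q? x ×-dec P? x) xs
  filter-filter P? Q? [] = refl
  filter-filter P? Q? (x ∷ xs) with Q? x
  ... | no _ = filter-filter P? Q? xs
  ... | yes _ with P? x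
  ...   | yes _ = cong (x ∷_) (filter-filter P? Q? xs)
  ...   | no _ = filter-filter P? Q? xs

  length-filter-map-suc : ∀ {P : Pred ℕ 0ℓ} (P? : Decidable P) m →
    length (filter P? (map suc (upTo m))) ≡ count (λ x → ⌊ P? (suc x) ⌋) m
  length-filter-map-suc P? m = trans (cong (length ∘′ filter P?) (map-upTo suc m)) (length-filter-applyUpTo P? suc m)

module Congruence (m : ℕ) .{{_ : NonZero m}} where

  open import Data.Nat
  open import Data.Nat.DivMod
  open import Data.Nat.Divisibility using (_∣_; m%n≡0⇒n∣m; n∣m⇒m%n≡0)
  open import Data.Nat.Properties
  open import Relation.Binary.Bundles using (Setoid)
  open import Relation.Binary.PropositionalEquality
  open import Relation.Nullary.Decidable using (Dec; map′)
  import Relation.Binary.Reasoning.Setoid as SetoidReasoning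

  -- A record rather than a synonym for a % m ≡ b % m, so that a and b stay inferable.
  infix 4 _≈_
  record _≈_ (a b : ℕ) : Set where
    constructor mod≡
    field %≡% : a % m ≡ b % m
  open _≈_ public

  ≈-refl : ∀ {a} → a ≈ a
  ≈-refl = mod≡ refl

  ≈-sym : ∀ {a b} → a ≈ b → b ≈ a
  ≈-sym (mod≡ e) = mod≡ (sym e)

  ≈-trans : ∀ {a b c} → a ≈ b → b ≈ c → a ≈ c
  ≈-trans (mod≡ e) (mod≡ f) = mod≡ (trans e f)

  infix 4 _≈?_
  _≈?_ : ∀ a b → Dec (a ≈ b)
  a ≈? b = map′ mod≡ %≡% (a % m ≟ b % m)

  ≡⇒≈ : ∀ {a b} → a ≡ b → a ≈ b
  ≡⇒≈ refl = ≈-refl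

  ≈-setoid : Setoid _ _
  ≈-setoid = record
    { Carrier = ℕ
    ; _≈_ = _≈_
    ; isEquivalence = record { refl = ≈-refl ; sym = ≈-sym ; trans = ≈-trans }
    }

  module ≈-Reasoning = SetoidReasoning ≈-setoid

  %-≈ : ∀ a → a % m ≈ a
  %-≈ a = mod≡ (m%n%n≡m%n a m)

  ≈⇒≡ : ∀ {a b} → a ≈ b → a < m → b < m → a ≡ b
  ≈⇒≡ {a} {b} (mod≡ e) a<m b<m = trans (sym (m<n⇒m%n≡m a<m)) (trans e (m<n⇒m%n≡m b<m))

  +-cong : ∀ {a b c d} → a ≈ b → c ≈ d → a + c ≈ b + d
  +-cong {a} {b} {c} {d} (mod≡ e₁) (mod≡ e₂) = mod≡ (begin
    (a + c) % m               ≡⟨ %-distribˡ-+ a c m ⟩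
    (a % m + c % m) % m       ≡⟨ cong₂ (λ x y → (x + y) % m) e₁ e₂ ⟩
    (b % m + d % m) % m       ≡⟨ %-distribˡ-+ b d m ⟨
    (b + d) % m               ∎)
    where open ≡-Reasoning

  +-congˡ : ∀ c {a b} → a ≈ b → c + a ≈ c + b
  +-congˡ c = +-cong (≈-refl {c})

  +-congʳ : ∀ c {a b} → a ≈ b → a + c ≈ b + c
  +-congʳ c a≈b = +-cong a≈b (≈-refl {c})

  *-cong : ∀ {a b c d} → a ≈ b → c ≈ d → a * c ≈ b * d
  *-cong {a} {b} {c} {d} (mod≡ e₁) (mod≡ e₂) = mod≡ (begin
    (a * c) % m               ≡⟨ %-distribˡ-* a c m ⟩
    (a % m * (c % m)) % m     ≡⟨ cong₂ (λ x y → (x * y) % m) e₁ e₂ ⟩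
    (b % m * (d % m)) % m     ≡⟨ %-distribˡ-* b d m ⟨
    (b * d) % m               ∎)
    where open ≡-Reasoning

  *-congˡ : ∀ c {a b} → a ≈ b → c * a ≈ c * b
  *-congˡ c = *-cong (≈-refl {c})

  *-congʳ : ∀ c {a b} → a ≈ b → a * c ≈ b * c
  *-congʳ c a≈b = *-cong a≈b (≈-refl {c})

  ^-congˡ : ∀ k {a b} → a ≈ b → a ^ k ≈ b ^ k
  ^-congˡ zero _ = ≈-refl
  ^-congˡ (suc k) a≈b = *-cong a≈b (^-congˡ k a≈b)

  ^-odd : ∀ {x} j → x * x ≈ 1 → x ^ suc (2 * j) ≈ x
  ^-odd {x} j x²≈1 = begin
      x * x ^ (2 * j)       ≡⟨ cong (x *_) (^-*-assoc x 2 j) ⟨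
      x * (x ^ 2) ^ j       ≡⟨ cong (λ y → x * y ^ j) (cong (x *_) (*-identityʳ x)) ⟩
      x * (x * x) ^ j       ≈⟨ *-congˡ x (^-congˡ j x²≈1) ⟩
      x * 1 ^ j             ≡⟨ cong (x *_) (^-zeroˡ j) ⟩
      x * 1                 ≡⟨ *-identityʳ x ⟩
      x                     ∎
    where open ≈-Reasoning

  a+k*m≈a : ∀ a k → a + k * m ≈ a
  a+k*m≈a a k = mod≡ ([m+kn]%n≡m%n a k m)

  k*m≈0 : ∀ k → k * m ≈ 0
  k*m≈0 k = a+k*m≈a 0 k

  m≈0 : m ≈ 0
  m≈0 = ≈-trans (≡⇒≈ (sym (*-identityˡ m))) (k*m≈0 1)

  -- Adding m ∸ c % m completes c to a multiple of m, which undoes the addition of c.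
  +-cancelʳ : ∀ c {a b} → a + c ≈ b + c → a ≈ b
  +-cancelʳ c {a} {b} a+c≈b+c = begin
      a                          ≈⟨ a+k*m≈a a (suc (c / m)) ⟨
      a + suc (c / m) * m        ≡⟨ shift a ⟩
      a + c + (m ∸ c % m)        ≈⟨ +-congʳ (m ∸ c % m) a+c≈b+c ⟩
      b + c + (m ∸ c % m)        ≡⟨ shift b ⟨
      b + suc (c / m) * m        ≈⟨ a+k*m≈a b (suc (c / m)) ⟩
      b                          ∎
    where
    open ≈-Reasoning
    c+[m∸c%m]≡[1+c/m]*m : c + (m ∸ c % m) ≡ suc (c / m) * m
    c+[m∸c%m]≡[1+c/m]*m = E.begin
      c + (m ∸ c % m)                      E.≡⟨ cong (_+ (m ∸ c % m)) (m≡m%n+[m/n]*n c m) ⟩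
      c % m + c / m * m + (m ∸ c % m)      E.≡⟨ cong (_+ (m ∸ c % m)) (+-comm (c % m) (c / m * m)) ⟩
      c / m * m + c % m + (m ∸ c % m)      E.≡⟨ +-assoc (c / m * m) (c % m) _ ⟩
      c / m * m + (c % m + (m ∸ c % m))    E.≡⟨ cong (c / m * m +_) (m+[n∸m]≡n (m%n≤n c m)) ⟩
      c / m * m + m                        E.≡⟨ +-comm (c / m * m) m ⟩
      suc (c / m) * m                      E.∎
      where module E = ≡-Reasoning
    shift : ∀ x → x + suc (c / m) * m ≡ x + c + (m ∸ c % m)
    shift x = trans (cong (x +_) (sym c+[m∸c%m]≡[1+c/m]*m)) (sym (+-assoc x c _))

  x+y≈0⇒x²≈y² : ∀ {x y} → x + y ≈ 0 → x * x ≈ y * y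
  x+y≈0⇒x²≈y² {x} {y} x+y≈0 = +-cancelʳ (x * y) (begin
      x * x + x * y     ≡⟨ *-distribˡ-+ x x y ⟨
      x * (x + y)       ≈⟨ *-congˡ x x+y≈0 ⟩
      x * 0             ≡⟨ *-zeroʳ x ⟩
      0                 ≈⟨ *-congʳ y x+y≈0 ⟨
      (x + y) * y       ≡⟨ *-distribʳ-+ y x y ⟩
      x * y + y * y     ≡⟨ +-comm (x * y) (y * y) ⟩
      y * y + x * y     ∎)
    where open ≈-Reasoning

  ≈0⇒∣ : ∀ {a} → a ≈ 0 → m ∣ a
  ≈0⇒∣ {a} (mod≡ e) = m%n≡0⇒n∣m a m (trans e (m*n%n≡0 0 m))

  ∣⇒≈0 : ∀ {a} → m ∣ a → a ≈ 0
  ∣⇒≈0 {a} m∣a = mod≡ (trans (n∣m⇒m%n≡0 a m m∣a) (sym (m*n%n≡0 0 m)))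

module Pairing (m : ℕ) .{{_ : NonZero m}} where

  open import Data.List using (List; []; _∷_; filter; length)
  open import Data.List.Membership.Propositional using (_∈_)
  open import Data.List.Membership.Propositional.Properties using (∈-filter⁺; ∈-filter⁻)
  open import Data.List.Properties using (filter-accept; filter-reject; filter-all)
  open import Data.List.Relation.Unary.All as All using (All)
  import Data.List.Relation.Unary.AllPairs as AllPairs
  open import Data.List.Relation.Unary.Any using (here; there)
  open import Data.List.Relation.Unary.Unique.Propositional using (Unique; _∷_)
  import Data.List.Relation.Unary.Unique.Propositional.Properties as Unique
  open import Data.Nat
  open import Data.Nat.ListAction using (product)
  open import Data.Nat.Properties
  open import Data.Product using (_×_; _,_; proj₁)
  open import Function using (_∘_)
  open import Relation.Binary.PropositionalEquality
  open import Relation.Nullary using (¬?; contradiction)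

  open Congruence m

  remove : ℕ → List ℕ → List ℕ
  remove y = filter (λ z → ¬? (z ≟ y))

  ∈-remove⁺ : ∀ {y z xs} → z ∈ xs → z ≢ y → z ∈ remove y xs
  ∈-remove⁺ {y} = ∈-filter⁺ (λ z → ¬? (z ≟ y))

  ∈-remove⁻ : ∀ {y z xs} → z ∈ remove y xs → z ∈ xs × z ≢ y
  ∈-remove⁻ {y} = ∈-filter⁻ (λ z → ¬? (z ≟ y))

  remove-unique : ∀ {y xs} → Unique xs → Unique (remove y xs)
  remove-unique {y} = Unique.filter⁺ (λ z → ¬? (z ≟ y))

  private
    remove-head : ∀ {y xs} → All (y ≢_) xs → remove y (y ∷ xs) ≡ xs
    remove-head {y} {xs} y∉xs = begin
      remove y (y ∷ xs)   ≡⟨ filter-reject (λ z → ¬? (z ≟ y)) (λ y≢y → y≢y refl) ⟩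
      remove y xs         ≡⟨ filter-all (λ z → ¬? (z ≟ y)) (All.map (λ y≢z → y≢z ∘ sym) y∉xs) ⟩
      xs                  ∎
      where open ≡-Reasoning

    remove-tail : ∀ {x y xs} → x ≢ y → remove y (x ∷ xs) ≡ x ∷ remove y xs
    remove-tail {y = y} = filter-accept (λ z → ¬? (z ≟ y))

  length-remove : ∀ {y xs} → Unique xs → y ∈ xs → length xs ≡ suc (length (remove y xs))
  length-remove (y∉xs ∷ _) (here refl) = cong (suc ∘ length) (sym (remove-head y∉xs))
  length-remove {y} {x ∷ xs} (x∉xs ∷ u) (there y∈xs) =
    trans (cong suc (length-remove u y∈xs)) (cong (suc ∘ length) (sym (remove-tail {xs = xs} (All.lookup x∉xs y∈xs))))

  product-remove : ∀ {y xs} → Unique xs → y ∈ xs → product xs ≡ y * product (remove y xs)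
  product-remove {y} (y∉xs ∷ _) (here refl) = cong (λ zs → y * product zs) (sym (remove-head y∉xs))
  product-remove {y} {x ∷ xs} (x∉xs ∷ u) (there y∈xs) = begin
      x * product xs                    ≡⟨ cong (x *_) (product-remove u y∈xs) ⟩
      x * (y * product (remove y xs))   ≡⟨ x∙yz≈y∙xz x y _ ⟩
      y * (x * product (remove y xs))
        ≡⟨ cong (λ zs → y * product zs) (remove-tail {xs = xs} (All.lookup x∉xs y∈xs)) ⟨
      y * product (remove y (x ∷ xs))   ∎
    where
    open ≡-Reasoning
    open import Algebra.Properties.CommutativeSemigroup *-commutativeSemigroup using (x∙yz≈y∙xz)

  record PairedBy (σ : ℕ → ℕ) (c : ℕ) (xs : List ℕ) : Set where
    field
      unique : Unique xs
      closed : ∀ {x} → x ∈ xs → σ x ∈ xs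
      involutive : ∀ {x} → x ∈ xs → σ (σ x) ≡ x
      fixed-point-free : ∀ {x} → x ∈ xs → σ x ≢ x
      pair-product : ∀ {x} → x ∈ xs → x * σ x ≈ c

  private
    module _ {σ c x xs} (paired : PairedBy σ c (x ∷ xs)) where
      open PairedBy paired
      open ≡-Reasoning

      σ-head∈tail : σ x ∈ xs
      σ-head∈tail with closed (here refl)
      ... | here σx≡x = contradiction σx≡x (fixed-point-free (here refl))
      ... | there σx∈xs = σx∈xs

      without-pair : PairedBy σ c (remove (σ x) xs)
      without-pair = record
        { unique = remove-unique (AllPairs.tail unique)
        ; closed = closed′
        ; involutive = involutive ∘ from-rest
        ; fixed-point-free = fixed-point-free ∘ from-rest
        ; pair-product = pair-product ∘ from-rest
        }
        where
        from-rest : ∀ {z} → z ∈ remove (σ x) xs → z ∈ x ∷ xs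
        from-rest = there ∘ proj₁ ∘ ∈-remove⁻
        closed′ : ∀ {z} → z ∈ remove (σ x) xs → σ z ∈ remove (σ x) xs
        closed′ {z} z∈rest with ∈-remove⁻ z∈rest | closed (from-rest z∈rest)
        ... | _ , z≢σx | here σz≡x = contradiction (trans (sym (involutive (from-rest z∈rest))) (cong σ σz≡x)) z≢σx
        ... | z∈xs , _ | there σz∈xs = ∈-remove⁺ σz∈xs σz≢σx
          where
          σz≢σx : σ z ≢ σ x
          σz≢σx σz≡σx = All.lookup (AllPairs.head unique) z∈xs (begin
            x          ≡⟨ involutive (here refl) ⟨
            σ (σ x)    ≡⟨ cong σ σz≡σx ⟨
            σ (σ z)    ≡⟨ involutive (there z∈xs) ⟩
            z          ∎)

  product-pairs : ∀ {σ c} j xs → PairedBy σ c xs → 2 * j ≡ length xs → product xs ≈ c ^ j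
  product-pairs zero [] _ _ = ≈-refl
  product-pairs {σ} {c} (suc j) (x ∷ xs) paired 2j+2≡len = begin
      x * product xs                    ≡⟨ cong (x *_) (product-remove xs-unique (σ-head∈tail paired)) ⟩
      x * (σ x * product rest)          ≡⟨ *-assoc x (σ x) _ ⟨
      x * σ x * product rest
        ≈⟨ *-cong (pair-product (here refl)) (product-pairs j rest (without-pair paired) 2j≡len) ⟩
      c * c ^ j                         ∎
    where
    open PairedBy paired
    open ≈-Reasoning
    xs-unique = AllPairs.tail unique
    rest = remove (σ x) xs
    2j≡len : 2 * j ≡ length rest
    2j≡len = suc-injective (suc-injective
      (trans (sym (*-suc 2 j)) (trans 2j+2≡len (cong suc (length-remove xs-unique (σ-head∈tail paired))))))

module PrimeField (k : ℕ) (p-prime : Prime (suc (2 * k))) where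

  open import Data.Nat
  open import Data.Nat.Coprimality using (coprime⇒gcd≡1; prime⇒coprime)
  import Data.Nat.Coprimality as Coprimality
  open import Data.Nat.DivMod
  open import Data.Nat.GCD using (gcd; gcd-GCD; module Bézout)
  open import Data.Nat.Primality using (euclidsLemma; prime⇒nonTrivial)
  open import Data.Nat.Properties
  open import Data.Nat.Tactic.RingSolver using (solve-∀)
  open import Data.Sum using (_⊎_; inj₁; inj₂)
  open import Relation.Binary.PropositionalEquality
  open import Relation.Nullary using (¬_; contradiction)

  p : ℕ
  p = suc (2 * k)

  open Congruence p public

  infix 4 _≉_
  _≉_ : ℕ → ℕ → Set
  a ≉ b = ¬ a ≈ b

  1<p : 1 < p
  1<p = nonTrivial⇒n>1 p {{prime⇒nonTrivial p-prime}}

  0<k : 0 < k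
  0<k = positive k 1<p
    where
    positive : ∀ j → 1 < suc (2 * j) → 0 < j
    positive zero (s≤s ())
    positive (suc j) _ = z<s

  1≉0 : 1 ≉ 0
  1≉0 1≈0 = 1+n≢0 (≈⇒≡ 1≈0 1<p z<s)

  ≉0⇒0< : ∀ {a} → a ≉ 0 → 0 < a
  ≉0⇒0< {zero} a≉0 = contradiction ≈-refl a≉0
  ≉0⇒0< {suc a} _ = z<s

  0<<p⇒≉0 : ∀ {a} → 0 < a → a < p → a ≉ 0
  0<<p⇒≉0 0<a a<p a≈0 = <⇒≢ 0<a (sym (≈⇒≡ a≈0 a<p (<-trans z<s 1<p)))

  *≈0⇒ : ∀ a b → a * b ≈ 0 → a ≈ 0 ⊎ b ≈ 0
  *≈0⇒ a b ab≈0 with euclidsLemma a b p-prime (≈0⇒∣ ab≈0)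
  ... | inj₁ p∣a = inj₁ (∣⇒≈0 p∣a)
  ... | inj₂ p∣b = inj₂ (∣⇒≈0 p∣b)

  *-≉0 : ∀ {a b} → a ≉ 0 → b ≉ 0 → a * b ≉ 0
  *-≉0 {a} {b} a≉0 b≉0 ab≈0 with *≈0⇒ a b ab≈0
  ... | inj₁ a≈0 = a≉0 a≈0
  ... | inj₂ b≈0 = b≉0 b≈0

  minus-one : ℕ
  minus-one = 2 * k

  minus-one+1≈0 : minus-one + 1 ≈ 0
  minus-one+1≈0 = ≈-trans (≡⇒≈ (+-comm minus-one 1)) m≈0

  minus-one²≈1 : minus-one * minus-one ≈ 1
  minus-one²≈1 = +-cancelʳ (2 * p) (begin
      minus-one * minus-one + 2 * p ≡⟨ identity k ⟩
      1 + p * p                     ≈⟨ a+k*m≈a 1 p ⟩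
      1                             ≈⟨ a+k*m≈a 1 2 ⟨
      1 + 2 * p                     ∎)
    where
    open ≈-Reasoning
    identity : ∀ k → 2 * k * (2 * k) + 2 * suc (2 * k) ≡ 1 + suc (2 * k) * suc (2 * k)
    identity = solve-∀

  minus-one*≈ : ∀ a → minus-one * a + a ≈ 0
  minus-one*≈ a = ≈-trans (≡⇒≈ (identity a k)) (k*m≈0 a)
    where
    identity : ∀ a k → 2 * k * a + a ≡ a * suc (2 * k)
    identity = solve-∀

  gcd[a%p,p]≡1 : ∀ a → a ≉ 0 → gcd (a % p) p ≡ 1
  gcd[a%p,p]≡1 a a≉0 = coprime⇒gcd≡1 (Coprimality.sym (prime⇒coprime p-prime {{a%p≢0}} (m%n<n a p)))
    where
    a%p≢0 : NonZero (a % p)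
    a%p≢0 = ≢-nonZero (λ a%p≡0 → a≉0 (mod≡ a%p≡0))

  -- Opaque: otherwise the type checker may unfold the Bézout computation on open terms.
  opaque
    inv : ℕ → ℕ
    inv a with Bézout.identity (gcd-GCD (a % p) p)
    ... | Bézout.+- x _ _ = x
    ... | Bézout.-+ x _ _ = x * minus-one

    *-inv : ∀ a → a ≉ 0 → a * inv a ≈ 1
    *-inv a a≉0 with Bézout.identity (gcd-GCD (a % p) p) | gcd[a%p,p]≡1 a a≉0
    ... | Bézout.+- x y eq | gcd≡1 = begin
        a * x                   ≈⟨ *-congʳ x (%-≈ a) ⟨
        a % p * x               ≡⟨ *-comm (a % p) x ⟩
        x * (a % p)             ≡⟨ eq ⟨
        gcd (a % p) p + y * p   ≈⟨ a+k*m≈a _ y ⟩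
        gcd (a % p) p           ≡⟨ gcd≡1 ⟩
        1                       ∎
      where open ≈-Reasoning
    ... | Bézout.-+ x y eq | gcd≡1 = begin
        a * (x * minus-one)     ≡⟨ *-assoc a x minus-one ⟨
        a * x * minus-one       ≈⟨ *-congʳ minus-one ax≈minus-one ⟩
        minus-one * minus-one   ≈⟨ minus-one²≈1 ⟩
        1                       ∎
      where
      open ≈-Reasoning
      ax≈minus-one : a * x ≈ minus-one
      ax≈minus-one = +-cancelʳ 1 (begin
        a * x + 1                   ≈⟨ +-congʳ 1 (*-congʳ x (%-≈ a)) ⟨
        a % p * x + 1               ≡⟨ cong₂ _+_ (*-comm (a % p) x) (sym gcd≡1) ⟩
        x * (a % p) + gcd (a % p) p ≡⟨ +-comm _ (gcd (a % p) p) ⟩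
        gcd (a % p) p + x * (a % p) ≡⟨ eq ⟩
        y * p                       ≈⟨ k*m≈0 y ⟩
        0                           ≈⟨ minus-one+1≈0 ⟨
        minus-one + 1               ∎)

  *-cancelˡ : ∀ c {a b} → c ≉ 0 → c * a ≈ c * b → a ≈ b
  *-cancelˡ c {a} {b} c≉0 ca≈cb = begin
      a                 ≡⟨ *-identityˡ a ⟨
      1 * a             ≈⟨ *-congʳ a (≈-trans (≡⇒≈ (*-comm (inv c) c)) (*-inv c c≉0)) ⟨
      inv c * c * a     ≡⟨ *-assoc (inv c) c a ⟩
      inv c * (c * a)   ≈⟨ *-congˡ (inv c) ca≈cb ⟩
      inv c * (c * b)   ≡⟨ *-assoc (inv c) c b ⟨
      inv c * c * b     ≈⟨ *-congʳ b (≈-trans (≡⇒≈ (*-comm (inv c) c)) (*-inv c c≉0)) ⟩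
      1 * b             ≡⟨ *-identityˡ b ⟩
      b                 ∎
    where open ≈-Reasoning

  square≈square⇒ : ∀ x y → x * x ≈ y * y → x ≈ y ⊎ x + y ≈ 0
  square≈square⇒ x y x²≈y² with *≈0⇒ (x + y) (x + minus-one * y) product≈0
    where
    -- (x + y) (x − y) = x² − y², with − y written as minus-one * y and y² moved to the left.
    identity : ∀ x y k → (x + y) * (x + 2 * k * y) + y * y ≡ x * x + (x * y + y * y) * suc (2 * k)
    identity = solve-∀
    product≈0 : (x + y) * (x + minus-one * y) ≈ 0
    product≈0 = +-cancelʳ (y * y) (begin
        (x + y) * (x + minus-one * y) + y * y ≡⟨ identity x y k ⟩
        x * x + (x * y + y * y) * p           ≈⟨ a+k*m≈a (x * x) (x * y + y * y) ⟩
        x * x                                 ≈⟨ x²≈y² ⟩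
        0 + y * y                             ∎)
      where open ≈-Reasoning
  ... | inj₁ x+y≈0 = inj₂ x+y≈0
  ... | inj₂ x-y≈0 = inj₁ (+-cancelʳ (minus-one * y) (begin
      x + minus-one * y   ≈⟨ x-y≈0 ⟩
      0                   ≈⟨ minus-one*≈ y ⟨
      minus-one * y + y   ≡⟨ +-comm (minus-one * y) y ⟩
      y + minus-one * y   ∎))
    where open ≈-Reasoning

  p∸s+s≈0 : ∀ {s} → s ≤ p → p ∸ s + s ≈ 0
  p∸s+s≈0 s≤p = ≈-trans (≡⇒≈ (m∸n+n≡m s≤p)) m≈0

  p∸s<p : ∀ {s} → 0 < s → s ≤ p → p ∸ s < p
  p∸s<p 0<s s≤p = ∸-monoʳ-< 0<s s≤p

  p∸s≢s : ∀ {s} → s ≤ p → p ∸ s ≢ s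
  p∸s≢s {s} s≤p p∸s≡s = even≢odd s k (begin
      2 * s       ≡⟨ cong (s +_) (+-identityʳ s) ⟩
      s + s       ≡⟨ cong (_+ s) p∸s≡s ⟨
      p ∸ s + s   ≡⟨ m∸n+n≡m s≤p ⟩
      p           ∎)
    where open ≡-Reasoning

  roots-of-square : ∀ {x s} → 0 < s → x < p → s < p → x * x ≈ s * s → x ≡ s ⊎ x ≡ p ∸ s
  roots-of-square {x} {s} 0<s x<p s<p x²≈s² with square≈square⇒ x s x²≈s²
  ... | inj₁ x≈s = inj₁ (≈⇒≡ x≈s x<p s<p)
  ... | inj₂ x+s≈0 = inj₂ (≈⇒≡ x≈p∸s x<p (p∸s<p 0<s (<⇒≤ s<p)))
    where
    x≈p∸s : x ≈ p ∸ s
    x≈p∸s = +-cancelʳ s (≈-trans x+s≈0 (≈-sym (p∸s+s≈0 (<⇒≤ s<p))))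

module EulerCriterion (k : ℕ) (p-prime : Prime (suc (2 * k))) where

  open import Data.Nat
  open import Data.Nat.DivMod
  open import Data.Nat.Properties
  open import Data.Bool using (Bool; true; false; T)
  open import Data.List using (List; length; applyUpTo; upTo)
  open import Data.List.Membership.Propositional using (_∈_; find; lose)
  open import Data.List.Membership.Propositional.Properties
    using (∈-applyUpTo⁺; ∈-applyUpTo⁻; ∈-upTo⁺; ∈-upTo⁻)
  open import Data.List.Relation.Unary.Any.Properties using (any⁺; any⁻)
  open import Data.List.Properties using (length-applyUpTo)
  open import Data.List.Relation.Unary.Unique.Propositional using (Unique)
  import Data.List.Relation.Unary.Unique.Propositional.Properties as Unique
  open import Data.Nat.ListAction using (product)
  open import Data.Product using (∃-syntax; _×_; _,_; proj₁; proj₂)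
  open import Data.Sum using (inj₁; inj₂)
  open import Function using (_∘_)
  open import Relation.Binary.PropositionalEquality
  open import Relation.Nullary using (¬_; contradiction)
  open import Relation.Nullary.Decidable using (toWitness; fromWitness)

  open import Defs using (isSquareMod)

  open PrimeField k p-prime public
  open Pairing p

  units : List ℕ
  units = applyUpTo suc minus-one

  ∈-units⁺ : ∀ {x} → 0 < x → x < p → x ∈ units
  ∈-units⁺ {suc x} _ (s≤s x<2k) = ∈-applyUpTo⁺ suc x<2k

  ∈-units⁻ : ∀ {x} → x ∈ units → 0 < x × x < p
  ∈-units⁻ x∈units with ∈-applyUpTo⁻ suc x∈units
  ... | _ , j<2k , refl = z<s , s≤s j<2k

  unit≉0 : ∀ {x} → x ∈ units → x ≉ 0
  unit≉0 x∈units = let (0<x , x<p) = ∈-units⁻ x∈units in 0<<p⇒≉0 0<x x<p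

  units-unique : Unique units
  units-unique = Unique.applyUpTo⁺₁ suc minus-one (λ i<j _ → <⇒≢ i<j ∘ suc-injective)

  length-units : length units ≡ 2 * k
  length-units = length-applyUpTo suc minus-one

  module Partner (a : ℕ) (a≉0 : a ≉ 0) where

    partner : ℕ → ℕ
    partner x = a * inv x % p

    partner<p : ∀ x → partner x < p
    partner<p x = m%n<n (a * inv x) p

    *-partner : ∀ {x} → x ∈ units → x * partner x ≈ a
    *-partner {x} x∈units = begin
        x * (a * inv x % p)   ≈⟨ *-congˡ x (%-≈ (a * inv x)) ⟩
        x * (a * inv x)       ≡⟨ x∙yz≈y∙xz x a (inv x) ⟩
        a * (x * inv x)       ≈⟨ *-congˡ a (*-inv x (unit≉0 x∈units)) ⟩
        a * 1                 ≡⟨ *-identityʳ a ⟩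
        a                     ∎
      where
      open ≈-Reasoning
      open import Algebra.Properties.CommutativeSemigroup *-commutativeSemigroup using (x∙yz≈y∙xz)

    partner∈units : ∀ {x} → x ∈ units → partner x ∈ units
    partner∈units {x} x∈units = ∈-units⁺ (≉0⇒0< partner≉0) (partner<p x)
      where
      partner≉0 : partner x ≉ 0
      partner≉0 partner≈0 = a≉0 (begin
        a               ≈⟨ *-partner x∈units ⟨
        x * partner x   ≈⟨ *-congˡ x partner≈0 ⟩
        x * 0           ≡⟨ *-zeroʳ x ⟩
        0               ∎)
        where open ≈-Reasoning

    partner-involutive : ∀ {x} → x ∈ units → partner (partner x) ≡ x
    partner-involutive {x} x∈units =
      ≈⇒≡ (*-cancelˡ (partner x) (unit≉0 y∈units) y*partner[y]≈y*x)
          (partner<p (partner x)) (proj₂ (∈-units⁻ x∈units))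
      where
      y∈units = partner∈units x∈units
      y*partner[y]≈y*x : partner x * partner (partner x) ≈ partner x * x
      y*partner[y]≈y*x =
        ≈-trans (*-partner y∈units) (≈-trans (≈-sym (*-partner x∈units)) (≡⇒≈ (*-comm x (partner x))))

    partner-fixed⇒square : ∀ {x} → x ∈ units → partner x ≡ x → x * x ≈ a
    partner-fixed⇒square {x} x∈units partner[x]≡x =
      ≈-trans (≡⇒≈ (cong (x *_) (sym partner[x]≡x))) (*-partner x∈units)

    square⇒partner-fixed : ∀ {x} → x ∈ units → x * x ≈ a → partner x ≡ x
    square⇒partner-fixed {x} x∈units x²≈a =
      ≈⇒≡ (*-cancelˡ x (unit≉0 x∈units) (≈-trans (*-partner x∈units) (≈-sym x²≈a)))
          (partner<p x) (proj₂ (∈-units⁻ x∈units))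

  IsSquare : ℕ → Set
  IsSquare a = ∃[ s ] s < p × s * s ≈ a

  product-units-nonsquare : ∀ a → a ≉ 0 → ¬ IsSquare a → product units ≈ a ^ k
  product-units-nonsquare a a≉0 ¬□a = product-pairs k units paired (sym length-units)
    where
    open Partner a a≉0
    paired : PairedBy partner a units
    paired = record
      { unique = units-unique
      ; closed = partner∈units
      ; involutive = partner-involutive
      ; fixed-point-free = λ x∈units fixed →
          ¬□a (_ , proj₂ (∈-units⁻ x∈units) , partner-fixed⇒square x∈units fixed)
      ; pair-product = *-partner
      }

  k≡1+pred[k] : k ≡ suc (pred k)
  k≡1+pred[k] = sym (suc-pred k {{>-nonZero 0<k}})

  -- When a = s², the partner map fixes exactly s and p − s, whose product is − a.
  module SquareCase (a s : ℕ) (a≉0 : a ≉ 0) (s<p : s < p) (s²≈a : s * s ≈ a) where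
    open Partner a a≉0

    t : ℕ
    t = p ∸ s

    0<s : 0 < s
    0<s = ≉0⇒0< (λ s≈0 → a≉0 (≈-trans (≈-sym s²≈a) (*-congʳ s s≈0)))

    t+s≈0 : t + s ≈ 0
    t+s≈0 = p∸s+s≈0 (<⇒≤ s<p)

    s∈units : s ∈ units
    s∈units = ∈-units⁺ 0<s s<p

    t∈units : t ∈ units
    t∈units = ∈-units⁺ (m<n⇒0<n∸m s<p) (p∸s<p 0<s (<⇒≤ s<p))

    others : List ℕ
    others = remove t (remove s units)

    ∈-others⁻ : ∀ {z} → z ∈ others → z ∈ units × z ≢ s × z ≢ t
    ∈-others⁻ z∈others =
      let (z∈units-s , z≢t) = ∈-remove⁻ z∈others
          (z∈units , z≢s) = ∈-remove⁻ z∈units-s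
      in z∈units , z≢s , z≢t

    others-paired : PairedBy partner a others
    others-paired = record
      { unique = remove-unique (remove-unique units-unique)
      ; closed = closed
      ; involutive = partner-involutive ∘ proj₁ ∘ ∈-others⁻
      ; fixed-point-free = fixed-point-free
      ; pair-product = *-partner ∘ proj₁ ∘ ∈-others⁻
      }
      where
      t²≈a : t * t ≈ a
      t²≈a = ≈-trans (x+y≈0⇒x²≈y² {t} {s} t+s≈0) s²≈a
      partner-reflects : ∀ {z w} → z ∈ units → w ∈ units → w * w ≈ a → partner z ≡ w → z ≡ w
      partner-reflects {z} {w} z∈units w∈units w²≈a partner[z]≡w = begin
        z                   ≡⟨ partner-involutive z∈units ⟨
        partner (partner z) ≡⟨ cong partner partner[z]≡w ⟩
        partner w           ≡⟨ square⇒partner-fixed w∈units w²≈a ⟩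
        w                   ∎
        where open ≡-Reasoning
      closed : ∀ {z} → z ∈ others → partner z ∈ others
      closed z∈others =
        let (z∈units , z≢s , z≢t) = ∈-others⁻ z∈others
        in ∈-remove⁺ (∈-remove⁺ (partner∈units z∈units) (z≢s ∘ partner-reflects z∈units s∈units s²≈a))
                     (z≢t ∘ partner-reflects z∈units t∈units t²≈a)
      fixed-point-free : ∀ {z} → z ∈ others → partner z ≢ z
      fixed-point-free z∈others fixed with ∈-others⁻ z∈others
      ... | z∈units , z≢s , z≢t
          with roots-of-square 0<s (proj₂ (∈-units⁻ z∈units)) s<p
                 (≈-trans (partner-fixed⇒square z∈units fixed) (≈-sym s²≈a))
      ... | inj₁ z≡s = z≢s z≡s
      ... | inj₂ z≡t = z≢t z≡t

    product-units : product units ≡ s * (t * product others)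
    product-units = trans (product-remove units-unique s∈units)
      (cong (s *_) (product-remove (remove-unique units-unique) (∈-remove⁺ t∈units (p∸s≢s (<⇒≤ s<p)))))

    length-others : 2 * pred k ≡ length others
    length-others = suc-injective (suc-injective (begin
      2 + 2 * pred k          ≡⟨ *-suc 2 (pred k) ⟨
      2 * suc (pred k)        ≡⟨ cong (2 *_) k≡1+pred[k] ⟨
      2 * k                   ≡⟨ length-units ⟨
      length units            ≡⟨ length-remove units-unique s∈units ⟩
      suc (length (remove s units))
        ≡⟨ cong suc (length-remove (remove-unique units-unique) (∈-remove⁺ t∈units (p∸s≢s (<⇒≤ s<p)))) ⟩
      2 + length others       ∎))
      where open ≡-Reasoning

    s*t+a≈0 : s * t + a ≈ 0
    s*t+a≈0 = begin
        s * t + a         ≈⟨ +-congˡ (s * t) s²≈a ⟨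
        s * t + s * s     ≡⟨ *-distribˡ-+ s t s ⟨
        s * (t + s)       ≈⟨ *-congˡ s t+s≈0 ⟩
        s * 0             ≡⟨ *-zeroʳ s ⟩
        0                 ∎
      where open ≈-Reasoning

  product-units-square : ∀ a s → a ≉ 0 → s < p → s * s ≈ a → product units + a ^ k ≈ 0
  product-units-square a s a≉0 s<p s²≈a = begin
      product units + a ^ k                   ≡⟨ cong₂ _+_ product-units (cong (a ^_) k≡1+pred[k]) ⟩
      s * (t * product others) + a * a ^ j    ≈⟨ +-congʳ (a * a ^ j) (*-congˡ s (*-congˡ t product-others)) ⟩
      s * (t * a ^ j) + a * a ^ j             ≡⟨ cong (_+ a * a ^ j) (*-assoc s t (a ^ j)) ⟨
      s * t * a ^ j + a * a ^ j               ≡⟨ *-distribʳ-+ (a ^ j) (s * t) a ⟨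
      (s * t + a) * a ^ j                     ≈⟨ *-congʳ (a ^ j) s*t+a≈0 ⟩
      0                                       ∎
    where
    open SquareCase a s a≉0 s<p s²≈a
    open ≈-Reasoning
    j = pred k
    product-others : product others ≈ a ^ j
    product-others = product-pairs j others others-paired length-others

  wilson : product units + 1 ≈ 0
  wilson = subst (λ x → product units + x ≈ 0) (^-zeroˡ k) (product-units-square 1 1 1≉0 1<p ≈-refl)

  euler-square : ∀ a → a ≉ 0 → IsSquare a → a ^ k ≈ 1
  euler-square a a≉0 (s , s<p , s²≈a) = +-cancelʳ (product units) (begin
      a ^ k + product units   ≡⟨ +-comm (a ^ k) _ ⟩
      product units + a ^ k   ≈⟨ product-units-square a s a≉0 s<p s²≈a ⟩
      0                       ≈⟨ wilson ⟨
      product units + 1       ≡⟨ +-comm _ 1 ⟩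
      1 + product units       ∎)
    where open ≈-Reasoning

  euler-nonsquare : ∀ a → a ≉ 0 → ¬ IsSquare a → a ^ k ≈ minus-one
  euler-nonsquare a a≉0 ¬□a = begin
      a ^ k           ≈⟨ product-units-nonsquare a a≉0 ¬□a ⟨
      product units   ≈⟨ +-cancelʳ 1 (≈-trans wilson (≈-sym minus-one+1≈0)) ⟩
      minus-one       ∎
    where open ≈-Reasoning

  isSquareMod⇒IsSquare : ∀ {a} → T (isSquareMod a p) → IsSquare a
  isSquareMod⇒IsSquare {a} sq with find (any⁻ _ (upTo p) sq)
  ... | s , s∈upTo , s²≡a = s , ∈-upTo⁻ s∈upTo , mod≡ (toWitness s²≡a)

  IsSquare⇒isSquareMod : ∀ {a} → IsSquare a → T (isSquareMod a p)
  IsSquare⇒isSquareMod (s , s<p , mod≡ s²≡a) = any⁺ _ (lose (∈-upTo⁺ s<p) (fromWitness s²≡a))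

  minus-one≉1 : minus-one ≉ 1
  minus-one≉1 -1≈1 = even≢odd k 0 (≈⇒≡ -1≈1 ≤-refl 1<p)

  sign : Bool → ℕ
  sign true = 1
  sign false = minus-one

  sign²≈1 : ∀ b → sign b * sign b ≈ 1
  sign²≈1 true = ≈-refl
  sign²≈1 false = minus-one²≈1

  sign-injective : ∀ {b c} → sign b ≈ sign c → b ≡ c
  sign-injective {true} {true} _ = refl
  sign-injective {true} {false} 1≈-1 = contradiction (≈-sym 1≈-1) minus-one≉1
  sign-injective {false} {true} -1≈1 = contradiction -1≈1 minus-one≉1
  sign-injective {false} {false} _ = refl

  euler : ∀ a → a ≉ 0 → a ^ k ≈ sign (isSquareMod a p)
  euler a a≉0 with isSquareMod a p in sq
  ... | true = euler-square a a≉0 (isSquareMod⇒IsSquare (subst T (sym sq) _))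
  ... | false = euler-nonsquare a a≉0 (λ □a → subst T sq (IsSquare⇒isSquareMod □a))

module QuadraticResidues (k : ℕ) (p-prime : Prime (suc (2 * k))) where

  open import Data.Nat
  open import Data.Nat.DivMod
  open import Data.Nat.Properties
  open import Data.Bool using (Bool; true; false; T; _∧_; not)
  import Data.Bool as Bool
  open import Data.Bool.Properties using (T-∧; ∧-identityʳ)
  open import Data.Product using (∃-syntax; _×_; _,_; proj₁; proj₂)
  open import Data.Sum using (inj₁; inj₂)
  open import Function using (_∘_; _⇔_; mk⇔; Equivalence)
  open import Relation.Binary.PropositionalEquality
  open import Relation.Nullary using (yes; no; contradiction)
  open import Relation.Nullary.Decidable using (⌊_⌋)

  open import Defs using (isSquareMod)

  open EulerCriterion k p-prime public
  open Arithmetic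
  open Counting

  half<p : ∀ {x} → x < k → suc x < p
  half<p x<k = s≤s (≤-trans x<k (m≤m+n k _))

  p∸suc≡suc-mirror : ∀ {x} → x < minus-one → p ∸ suc x ≡ suc (minus-one ∸ suc x)
  p∸suc≡suc-mirror x<2k = +-∸-assoc 1 x<2k

  k<p∸suc : ∀ {y} → y < k → k < p ∸ suc y
  k<p∸suc {y} y<k = begin-strict
      k                       <⟨ m<m+n k (m<n⇒0<n∸m y<k) ⟩
      k + (k ∸ y)             ≡⟨ +-∸-assoc k (<⇒≤ y<k) ⟨
      k + k ∸ y               ≡⟨ cong (λ z → k + z ∸ y) (+-identityʳ k) ⟨
      p ∸ suc y               ∎
    where open ≤-Reasoning

  -- The root x + 1 of a lies in 1 … k; every nonzero square has exactly one such root.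
  HalfRoot : ℕ → Set
  HalfRoot a = ∃[ x ] x < k × suc x * suc x ≈ a

  halfRoot-unique : ∀ {x y} → x < k → y < k → suc x * suc x ≈ suc y * suc y → x ≡ y
  halfRoot-unique {x} {y} x<k y<k sx²≈sy² with roots-of-square z<s (half<p x<k) (half<p y<k) sx²≈sy²
  ... | inj₁ sx≡sy = suc-injective sx≡sy
  ... | inj₂ sx≡p∸sy =
    contradiction (≤-trans (k<p∸suc y<k) (≤-reflexive (sym sx≡p∸sy))) (<⇒≱ x<k ∘ ≤-pred)

  square⇒HalfRoot : ∀ {a} → a ≉ 0 → IsSquare a → HalfRoot a
  square⇒HalfRoot a≉0 (zero , _ , 0≈a) = contradiction (≈-sym 0≈a) a≉0
  square⇒HalfRoot a≉0 (suc x , sx<p , sx²≈a) with suc x ≤? k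
  ... | yes sx≤k = x , sx≤k , sx²≈a
  ... | no sx≰k = minus-one ∸ suc x , mirror<k , ≈-trans mirror²≈sx² sx²≈a
    where
    x<2k : x < minus-one
    x<2k = ≤-pred sx<p
    mirror<k : minus-one ∸ suc x < k
    mirror<k = m<n+o⇒m∸n<o minus-one (suc x) {{>-nonZero 0<k}}
      (subst (_< suc x + k) (cong (k +_) (sym (+-identityʳ k))) (+-monoˡ-< k (≰⇒> sx≰k)))
    mirror²≈sx² : suc (minus-one ∸ suc x) * suc (minus-one ∸ suc x) ≈ suc x * suc x
    mirror²≈sx² = subst (λ t → t * t ≈ suc x * suc x) (p∸suc≡suc-mirror x<2k)
      (x+y≈0⇒x²≈y² {p ∸ suc x} {suc x} (p∸s+s≈0 (<⇒≤ sx<p)))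

  halfRoot : ℕ → ℕ
  halfRoot a with anyUpTo? (λ x → suc x * suc x ≈? a) k
  ... | yes (x , _) = x
  ... | no _ = 0

  halfRoot-correct : ∀ {a} → HalfRoot a → halfRoot a < k × suc (halfRoot a) * suc (halfRoot a) ≈ a
  halfRoot-correct {a} root with anyUpTo? (λ x → suc x * suc x ≈? a) k
  ... | yes (_ , x<k , sx²≈a) = x<k , sx²≈a
  ... | no ¬root = contradiction root ¬root

  isNonzeroSquare : ℕ → Bool
  isNonzeroSquare a = (0 <ᵇ a) ∧ isSquareMod a p

  count-nonzero-squares : ∀ (F : ℕ → Bool) → (∀ {a b} → a ≈ b → F a ≡ F b) →
    count (λ a → isNonzeroSquare a ∧ F a) p ≡ count (λ x → F (suc x * suc x)) k
  count-nonzero-squares F F-resp = sym (count-inverse _ _ square halfRoot k p to from)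
    where
    square : ℕ → ℕ
    square x = suc x * suc x % p
    to : ∀ x → x < k → T (F (suc x * suc x)) →
         square x < p × T (isNonzeroSquare (square x) ∧ F (square x)) × halfRoot (square x) ≡ x
    to x x<k Fx² = m%n<n (suc x * suc x) p
                 , Equivalence.from T-∧ (Equivalence.from T-∧ (nonzero , square?) , F-square)
                 , inverse
      where
      sx≉0 = 0<<p⇒≉0 z<s (half<p x<k)
      square≈ : square x ≈ suc x * suc x
      square≈ = %-≈ (suc x * suc x)
      nonzero : T (0 <ᵇ square x)
      nonzero = <⇒<ᵇ (≉0⇒0< (*-≉0 sx≉0 sx≉0 ∘ ≈-trans (≈-sym square≈)))
      square? : T (isSquareMod (square x) p)
      square? = IsSquare⇒isSquareMod (suc x , half<p x<k , ≈-sym square≈)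
      F-square : T (F (square x))
      F-square = subst T (F-resp (≈-sym square≈)) Fx²
      inverse : halfRoot (square x) ≡ x
      inverse = let (r<k , r²≈) = halfRoot-correct (x , x<k , ≈-sym square≈)
                in halfRoot-unique r<k x<k (≈-trans r²≈ square≈)
    from : ∀ a → a < p → T (isNonzeroSquare a ∧ F a) →
           halfRoot a < k × T (F (suc (halfRoot a) * suc (halfRoot a))) × square (halfRoot a) ≡ a
    from a a<p sqa = r<k
                   , subst T (F-resp (≈-sym r²≈a)) Fa
                   , ≈⇒≡ (≈-trans (%-≈ _) r²≈a) (m%n<n (suc (halfRoot a) * suc (halfRoot a)) p) a<p
      where
      parts = Equivalence.to T-∧ sqa
      nonzero-square = Equivalence.to T-∧ (proj₁ parts)
      Fa = proj₂ parts
      a≉0 = 0<<p⇒≉0 (<ᵇ⇒< 0 a (proj₁ nonzero-square)) a<p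
      root = halfRoot-correct (square⇒HalfRoot a≉0 (isSquareMod⇒IsSquare (proj₂ nonzero-square)))
      r<k = proj₁ root
      r²≈a = proj₂ root

  count-nonzero-squares≡k : count isNonzeroSquare p ≡ k
  count-nonzero-squares≡k = begin
      count isNonzeroSquare p                            ≡⟨ count-cong p (λ a _ → ∧-identityʳ _) ⟨
      count (λ a → isNonzeroSquare a ∧ true) p           ≡⟨ count-nonzero-squares (λ _ → true) (λ _ → refl) ⟩
      count (λ _ → true) k                               ≡⟨ count-true k ⟩
      k                                                  ∎
    where open ≡-Reasoning

  module OneModFour (h : ℕ) (k≡h+h : k ≡ h + h) where

    minus-one^k≈1 : minus-one ^ k ≈ 1
    minus-one^k≈1 = begin
        minus-one ^ k                    ≡⟨ cong (minus-one ^_) k≡h+h ⟩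
        minus-one ^ (h + h)              ≡⟨ ^-distribˡ-+-* minus-one h h ⟩
        minus-one ^ h * minus-one ^ h    ≡⟨ ^-distribʳ-* minus-one minus-one h ⟨
        (minus-one * minus-one) ^ h      ≈⟨ ^-congˡ h minus-one²≈1 ⟩
        1 ^ h                            ≡⟨ ^-zeroˡ h ⟩
        1                                ∎
      where open ≈-Reasoning

    isSquareMod-negate : ∀ {y} → 0 < y → y < p → isSquareMod (p ∸ y) p ≡ isSquareMod y p
    isSquareMod-negate {y} 0<y y<p = sign-injective (begin
        sign (isSquareMod (p ∸ y) p)     ≈⟨ euler (p ∸ y) p∸y≉0 ⟨
        (p ∸ y) ^ k                      ≈⟨ ^-congˡ k p∸y≈-y ⟩
        (minus-one * y) ^ k              ≡⟨ ^-distribʳ-* minus-one y k ⟩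
        minus-one ^ k * y ^ k            ≈⟨ *-congʳ (y ^ k) minus-one^k≈1 ⟩
        1 * y ^ k                        ≡⟨ *-identityˡ (y ^ k) ⟩
        y ^ k                            ≈⟨ euler y (0<<p⇒≉0 0<y y<p) ⟩
        sign (isSquareMod y p)           ∎)
      where
      open ≈-Reasoning
      p∸y≉0 : p ∸ y ≉ 0
      p∸y≉0 = 0<<p⇒≉0 (m<n⇒0<n∸m y<p) (p∸s<p 0<y (<⇒≤ y<p))
      p∸y≈-y : p ∸ y ≈ minus-one * y
      p∸y≈-y = +-cancelʳ y (≈-trans (p∸s+s≈0 (<⇒≤ y<p)) (≈-sym (minus-one*≈ y)))

    private
      S : ℕ → Bool
      S x = isSquareMod (suc x) p

      upper-half≡lower-half : count (λ x → S (k + x)) k ≡ count S k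
      upper-half≡lower-half = count-permutation _ _ mirror k mirror<k mirror-injective upper≡mirror
        where
        mirror : ℕ → ℕ
        mirror x = k ∸ suc x
        mirror<k : ∀ x → x < k → mirror x < k
        mirror<k x x<k = <-≤-trans (∸-monoʳ-< z<s x<k) ≤-refl
        mirror-injective : ∀ x y → x < k → y < k → mirror x ≡ mirror y → x ≡ y
        mirror-injective x y x<k y<k e = suc-injective (∸-cancelˡ-≡ x<k y<k e)
        upper≡mirror : ∀ x → x < k → S (k + x) ≡ S (mirror x)
        upper≡mirror x x<k = begin
            isSquareMod (suc (k + x)) p            ≡⟨ isSquareMod-negate z<s sk+x<p ⟨
            isSquareMod (p ∸ suc (k + x)) p        ≡⟨ cong (λ z → isSquareMod z p) p∸[1+k+x]≡1+mirror ⟩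
            isSquareMod (suc (mirror x)) p         ∎
          where
          open ≡-Reasoning
          sk+x<p : suc (k + x) < p
          sk+x<p = s≤s (+-monoʳ-< k (<-≤-trans x<k (m≤m+n k 0)))
          p∸[1+k+x]≡1+mirror : p ∸ suc (k + x) ≡ suc (mirror x)
          p∸[1+k+x]≡1+mirror = begin
            k + (k + 0) ∸ (k + x)   ≡⟨ [m+n]∸[m+o]≡n∸o k (k + 0) x ⟩
            k + 0 ∸ x               ≡⟨ cong (_∸ x) (+-identityʳ k) ⟩
            k ∸ x                   ≡⟨ +-∸-assoc 1 x<k ⟩
            suc (mirror x)          ∎

    count-squares-lower-half : count S k ≡ h
    count-squares-lower-half = *-cancelˡ-≡ _ _ 2 (begin
        2 * count S k                            ≡⟨ cong (count S k +_) (+-identityʳ _) ⟩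
        count S k + count S k                    ≡⟨ cong (count S k +_) upper-half≡lower-half ⟨
        count S k + count (λ x → S (k + x)) k    ≡⟨ count-+ S k k ⟨
        count S (k + k)                          ≡⟨ cong (count S) (cong (k +_) (+-identityʳ k)) ⟨
        count S minus-one                        ≡⟨ count-suc isNonzeroSquare minus-one ⟨
        count isNonzeroSquare p                  ≡⟨ count-nonzero-squares≡k ⟩
        k                                        ≡⟨ k≡h+h ⟩
        h + h                                    ≡⟨ cong (h +_) (+-identityʳ h) ⟨
        2 * h                                    ∎)
      where open ≡-Reasoning

    square^h≈sign : ∀ {x} → x < k → (suc x * suc x) ^ h ≈ sign (isSquareMod (suc x) p)
    square^h≈sign {x} x<k = begin
        (suc x * suc x) ^ h          ≡⟨ ^-distribʳ-* (suc x) (suc x) h ⟩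
        suc x ^ h * suc x ^ h        ≡⟨ ^-distribˡ-+-* (suc x) h h ⟨
        suc x ^ (h + h)              ≡⟨ cong (suc x ^_) k≡h+h ⟨
        suc x ^ k                    ≈⟨ euler (suc x) (0<<p⇒≉0 z<s (half<p x<k)) ⟩
        sign (isSquareMod (suc x) p) ∎
      where open ≈-Reasoning

    count-quartic : ∀ b → count (λ v → isNonzeroSquare v ∧ ⌊ v ^ h ≈? sign b ⌋) p ≡ h
    count-quartic b = begin
        count (λ v → isNonzeroSquare v ∧ ⌊ v ^ h ≈? sign b ⌋) p
          ≡⟨ count-nonzero-squares (λ v → ⌊ v ^ h ≈? sign b ⌋) power-resp ⟩
        count (λ x → ⌊ (suc x * suc x) ^ h ≈? sign b ⌋) k
          ≡⟨ count-cong k (λ x x<k →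
               ⌊⌋-⇔ (euler-square-root x x<k) ((suc x * suc x) ^ h ≈? sign b) (S x Bool.≟ b)) ⟩
        count (λ x → ⌊ S x Bool.≟ b ⌋) k
          ≡⟨ count-by-b b ⟩
        h ∎
      where
      open ≡-Reasoning
      power-resp : ∀ {v w} → v ≈ w → ⌊ v ^ h ≈? sign b ⌋ ≡ ⌊ w ^ h ≈? sign b ⌋
      power-resp {v} {w} v≈w = ⌊⌋-⇔ (mk⇔ (≈-trans (^-congˡ h (≈-sym v≈w))) (≈-trans (^-congˡ h v≈w)))
        (v ^ h ≈? sign b) (w ^ h ≈? sign b)
      euler-square-root : ∀ x → x < k → (suc x * suc x) ^ h ≈ sign b ⇔ S x ≡ b
      euler-square-root x x<k = mk⇔ (λ e → sign-injective (≈-trans (≈-sym (square^h≈sign x<k)) e))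
                                    (λ e → ≈-trans (square^h≈sign x<k) (≡⇒≈ (cong sign e)))
      count-by-b : ∀ b → count (λ x → ⌊ S x Bool.≟ b ⌋) k ≡ h
      count-by-b true = trans (count-cong k (λ x _ → ⌊≟true⌋ (S x))) count-squares-lower-half
      count-by-b false = +-cancelˡ-≡ h _ _ (begin
          h + count (λ x → ⌊ S x Bool.≟ false ⌋) k
            ≡⟨ cong₂ _+_ (sym count-squares-lower-half) (count-cong k (λ x _ → ⌊≟false⌋ (S x))) ⟩
          count S k + count (λ x → not (S x)) k      ≡⟨ count-not S k ⟩
          k                                          ≡⟨ k≡h+h ⟩
          h + h                                      ∎)

module Jacobi where

  open import Data.Integer as ℤ using (ℤ; +_)
  import Data.Integer.Properties as ℤ
  open import Data.Nat
  open import Data.Nat.Coprimality using (coprime-divisor; prime⇒coprime)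
  import Data.Nat.Coprimality as Coprimality
  open import Data.Nat.DivMod using (m*n/n≡m; n/n≡1; /-congʳ)
  open import Data.Nat.Divisibility
  open import Data.Nat.Primality
  open import Data.Nat.Properties
  open import Relation.Binary.PropositionalEquality
  open import Relation.Nullary using (yes; no)

  open import Defs using (lpfOffset; lpf; legendre; jacobiAux; jacobi)

  lpfOffset≡ : ∀ fuel {d m t} → d ≤ t → t ≤ d + fuel → (2 + t) Rough m → (2 + t) ∣ m →
    lpfOffset fuel d m ≡ t
  lpfOffset≡ zero {d} {t = t} d≤t t≤d+0 _ _ = ≤-antisym d≤t (subst (t ≤_) (+-identityʳ d) t≤d+0)
  lpfOffset≡ (suc fuel) {d} {m} {t} d≤t t≤d+1+fuel rough [2+t]∣m with (2 + d) ∣? m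
  ... | yes [2+d]∣m = ≤-antisym d≤t (≮⇒≥ (λ d<t → rough (hasNonTrivialDivisor (s≤s (s≤s d<t)) [2+d]∣m)))
  ... | no [2+d]∤m = lpfOffset≡ fuel d<t (subst (t ≤_) (+-suc d fuel) t≤d+1+fuel) rough [2+t]∣m
    where
    d<t : d < t
    d<t = ≤∧≢⇒< d≤t (λ { refl → [2+d]∤m [2+t]∣m })

  lpf≡ : ∀ {m p} → .{{NonTrivial p}} → p ≤ m → p ∣ m → p Rough m → lpf m ≡ p
  lpf≡ {m} {2+ t} p≤m p∣m rough = cong (λ x → 2 + x) (lpfOffset≡ m z≤n (≤-trans (m≤n+m t 2) p≤m) rough p∣m)

  prime-rough-product : ∀ {q r} → Prime q → Prime r → q < r → q Rough (q * r)
  prime-rough-product {q} {r} q-prime (prime r-not-composite) q<r (hasNonTrivialDivisor {d} d<q d∣qr) =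
    r-not-composite (composite (<-trans d<q q<r) d∣r)
    where
    instance _ = nonTrivial⇒nonZero d
    d∣r : d ∣ r
    d∣r = coprime-divisor (Coprimality.sym (prime⇒coprime q-prime d<q)) d∣qr

  jacobiAux-step : ∀ f a m → 1 < m → jacobiAux (suc f) a m ≡ legendre a (lpf m) ℤ.* jacobiAux f a (m / lpf m)
  jacobiAux-step f a (suc zero) (s≤s ())
  jacobiAux-step f a (suc (suc m)) _ = refl

  jacobiAux-one : ∀ f a → jacobiAux f a 1 ≡ + 1
  jacobiAux-one zero a = refl
  jacobiAux-one (suc f) a = refl

  jacobiAux-prime : ∀ f a {r} → Prime r → jacobiAux (suc f) a r ≡ legendre a r
  jacobiAux-prime f a {r} r-prime = begin
      jacobiAux (suc f) a r                                  ≡⟨ jacobiAux-step f a r (nonTrivial⇒n>1 r) ⟩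
      legendre a (lpf r) ℤ.* jacobiAux f a (r / lpf r)
        ≡⟨ cong₂ (λ x y → legendre a x ℤ.* jacobiAux f a y) lpf[r]≡r r/lpf[r]≡1 ⟩
      legendre a r ℤ.* jacobiAux f a 1                       ≡⟨ cong (legendre a r ℤ.*_) (jacobiAux-one f a) ⟩
      legendre a r ℤ.* + 1                                   ≡⟨ ℤ.*-identityʳ (legendre a r) ⟩
      legendre a r                                           ∎
    where
    open ≡-Reasoning
    instance
      _ = prime⇒nonTrivial r-prime
      _ = prime⇒nonZero r-prime
    lpf[r]≡r : lpf r ≡ r
    lpf[r]≡r = lpf≡ ≤-refl ∣-refl (prime⇒rough r-prime)
    r/lpf[r]≡1 : r / lpf r ≡ 1
    r/lpf[r]≡1 = trans (/-congʳ lpf[r]≡r) (n/n≡1 r)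

  jacobi-product : ∀ a {q r} → Prime q → Prime r → q < r → jacobi a (q * r) ≡ legendre a q ℤ.* legendre a r
  jacobi-product a {q} {r} q-prime r-prime q<r = with-fuel (q * r) 1<qr
    where
    open ≡-Reasoning
    instance
      _ = prime⇒nonTrivial q-prime
      _ = prime⇒nonZero q-prime
      _ = prime⇒nonZero r-prime
    q≤qr : q ≤ q * r
    q≤qr = m≤m*n q r
    1<qr : 1 < q * r
    1<qr = <-≤-trans (nonTrivial⇒n>1 q) q≤qr
    lpf[qr]≡q : lpf (q * r) ≡ q
    lpf[qr]≡q = lpf≡ q≤qr (m∣m*n r) (prime-rough-product q-prime r-prime q<r)
    qr/lpf[qr]≡r : q * r / lpf (q * r) ≡ r
    qr/lpf[qr]≡r = trans (/-congʳ lpf[qr]≡q) (trans (cong (_/ q) (*-comm q r)) (m*n/n≡m r q))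
    with-fuel : ∀ f → 2 ≤ f → jacobiAux f a (q * r) ≡ legendre a q ℤ.* legendre a r
    with-fuel (suc zero) (s≤s ())
    with-fuel (suc (suc f)) _ = begin
      jacobiAux (2 + f) a (q * r)                                  ≡⟨ jacobiAux-step (suc f) a (q * r) 1<qr ⟩
      legendre a (lpf (q * r)) ℤ.* jacobiAux (suc f) a (q * r / lpf (q * r))
        ≡⟨ cong₂ (λ x y → legendre a x ℤ.* jacobiAux (suc f) a y) lpf[qr]≡q qr/lpf[qr]≡r ⟩
      legendre a q ℤ.* jacobiAux (suc f) a r
        ≡⟨ cong (legendre a q ℤ.*_) (jacobiAux-prime f a r-prime) ⟩
      legendre a q ℤ.* legendre a r                                ∎

module TwoPrimes {q r : ℕ} (q-prime : Prime q) (r-prime : Prime r) (q<r : q < r) where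

  open import Data.Bool using (Bool; _∧_; T)
  open import Data.Bool.Properties using (T-∧)
  open import Data.Nat
  open import Data.Nat.Coprimality using (Coprime; coprime?; coprime-divisor)
  open import Data.Nat.DivMod
  open import Data.Nat.Divisibility
  open import Data.Nat.Primality using (prime⇒irreducible; prime⇒nonZero; prime⇒nonTrivial)
  open import Data.Nat.Properties
  open import Data.Product using (_×_; _,_)
  open import Data.Product.Function.NonDependent.Propositional using (_×-⇔_)
  open import Data.Sum using (inj₁; inj₂)
  open import Function using (_∘′_; _⇔_; mk⇔)
  open import Function.Construct.Composition using (_⇔-∘_)
  open import Function.Construct.Symmetry using (⇔-sym)
  open import Relation.Binary.PropositionalEquality
  open import Relation.Nullary using (¬_; contradiction)
  open import Relation.Nullary.Decidable using (⌊_⌋)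

  open Arithmetic
  open Counting

  instance
    _ = prime⇒nonZero q-prime
    _ = prime⇒nonZero r-prime

  ∤⇒coprime : ∀ {p a} → Prime p → ¬ p ∣ a → Coprime p a
  ∤⇒coprime p-prime p∤a (d∣p , d∣a) with prime⇒irreducible p-prime d∣p
  ... | inj₁ d≡1 = d≡1
  ... | inj₂ refl = contradiction d∣a p∤a

  ∤⇔0<ᵇ% : ∀ {p a} .{{_ : NonZero p}} → (¬ p ∣ a) ⇔ T (0 <ᵇ a % p)
  ∤⇔0<ᵇ% {p} {a} = mk⇔ (λ p∤a → <⇒<ᵇ (n≢0⇒n>0 (p∤a ∘′ m%n≡0⇒n∣m a p)))
                        (λ 0<a%p p∣a → <⇒≢ (<ᵇ⇒< 0 (a % p) 0<a%p) (sym (n∣m⇒m%n≡0 a p p∣a)))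

  coprime⇔∤∤ : ∀ a → Coprime a (q * r) ⇔ (¬ q ∣ a × ¬ r ∣ a)
  coprime⇔∤∤ a = mk⇔ to from
    where
    not-unit : ∀ {p} → Prime p → p ≢ 1
    not-unit p-prime = nonTrivial⇒≢1 {{prime⇒nonTrivial p-prime}}
    to : Coprime a (q * r) → ¬ q ∣ a × ¬ r ∣ a
    to coprime = (λ q∣a → not-unit q-prime (coprime (q∣a , m∣m*n r)))
               , (λ r∣a → not-unit r-prime (coprime (r∣a , n∣m*n q)))
    from : ¬ q ∣ a × ¬ r ∣ a → Coprime a (q * r)
    from (q∤a , r∤a) (d∣a , d∣qr) = ∤⇒coprime r-prime r∤a (d∣r , d∣a)
      where
      d∣r = coprime-divisor (λ (e∣d , e∣q) → ∤⇒coprime q-prime q∤a (e∣q , ∣-trans e∣d d∣a)) d∣qr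

  isUnit≡ : ∀ a → ⌊ coprime? a (q * r) ⌋ ≡ (0 <ᵇ a % q) ∧ (0 <ᵇ a % r)
  isUnit≡ a =
    ⌊⌋-reflects (⇔-sym T-∧ ⇔-∘ ((∤⇔0<ᵇ% ×-⇔ ∤⇔0<ᵇ%) ⇔-∘ coprime⇔∤∤ a)) (coprime? a (q * r))

  private
    ≡mod⇒∣∸ : ∀ {p x y} .{{_ : NonZero p}} → x ≤ y → x % p ≡ y % p → p ∣ y ∸ x
    ≡mod⇒∣∸ {p} {x} {y} x≤y x≡y =
      ≈0⇒∣ (+-cancelʳ x (mod≡ (trans (cong (_% p) (m∸n+n≡m x≤y)) (sym x≡y))))
      where open Congruence p

    ∣∣⇒product∣ : ∀ {d} → q ∣ d → r ∣ d → q * r ∣ d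
    ∣∣⇒product∣ {d} (divides c d≡c*q) r∣d = subst (q * r ∣_) q*c≡d (*-monoʳ-∣ q r∣c)
      where
      q*c≡d : q * c ≡ d
      q*c≡d = trans (*-comm q c) (sym d≡c*q)
      r∣c : r ∣ c
      r∣c = coprime-divisor (∤⇒coprime r-prime (λ r∣q → <⇒≱ q<r (∣⇒≤ r∣q)))
                            (subst (r ∣_) (sym q*c≡d) r∣d)

    crt-injective-≤ : ∀ {x y} → x ≤ y → y < q * r → x % q ≡ y % q → x % r ≡ y % r → x ≡ y
    crt-injective-≤ {x} {y} x≤y y<qr x≡y[q] x≡y[r] = ≤-antisym x≤y (m∸n≡0⇒m≤n y∸x≡0)
      where
      instance _ = m*n≢0 q r
      qr∣y∸x : q * r ∣ y ∸ x
      qr∣y∸x = ∣∣⇒product∣ (≡mod⇒∣∸ x≤y x≡y[q]) (≡mod⇒∣∸ x≤y x≡y[r])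
      y∸x≡0 : y ∸ x ≡ 0
      y∸x≡0 = trans (sym (m<n⇒m%n≡m (≤-<-trans (m∸n≤m y x) y<qr))) (n∣m⇒m%n≡0 (y ∸ x) (q * r) qr∣y∸x)

  crt-injective : ∀ {x y} → x < q * r → y < q * r → x % q ≡ y % q → x % r ≡ y % r → x ≡ y
  crt-injective {x} {y} x<qr y<qr x≡y[q] x≡y[r] with ≤-total x y
  ... | inj₁ x≤y = crt-injective-≤ x≤y y<qr x≡y[q] x≡y[r]
  ... | inj₂ y≤x = sym (crt-injective-≤ y≤x x<qr (sym x≡y[q]) (sym x≡y[r]))

  count-crt : ∀ (C : ℕ → ℕ → Bool) (g : ℕ → Bool) K →
    (∀ u → u < q → count (C u) r ≡ toℕ (g u) * K) →
    count (λ a → C (a % q) (a % r)) (q * r) ≡ count g q * K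
  count-crt C g K rows = trans (count-permutation _ _ crt (q * r) crt<qr crt-inj C∘crt) (count-rows C g K q r rows)
    where
    crt : ℕ → ℕ
    crt a = a % q * r + a % r
    crt<qr : ∀ a → a < q * r → crt a < q * r
    crt<qr a _ = begin-strict
      a % q * r + a % r     <⟨ +-monoʳ-< (a % q * r) (m%n<n a r) ⟩
      a % q * r + r         ≡⟨ +-comm (a % q * r) r ⟩
      suc (a % q) * r       ≤⟨ *-monoˡ-≤ r (m%n<n a q) ⟩
      q * r                 ∎
      where open ≤-Reasoning
    crt/r : ∀ a → crt a / r ≡ a % q
    crt/r a = [u*r+x]/r≡u (a % q) r (m%n<n a r)
    crt%r : ∀ a → crt a % r ≡ a % r
    crt%r a = [u*r+x]%r≡x (a % q) r (m%n<n a r)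
    crt-inj : ∀ x y → x < q * r → y < q * r → crt x ≡ crt y → x ≡ y
    crt-inj x y x<qr y<qr crt-x≡crt-y = crt-injective x<qr y<qr
      (trans (sym (crt/r x)) (trans (cong (_/ r) crt-x≡crt-y) (crt/r y)))
      (trans (sym (crt%r x)) (trans (cong (_% r) crt-x≡crt-y) (crt%r y)))
    C∘crt : ∀ a → a < q * r → C (a % q) (a % r) ≡ C (crt a / r) (crt a % r)
    C∘crt a _ = sym (cong₂ C (crt/r a) (crt%r a))

module Liars (k : ℕ) (q-prime : Prime (suc (2 * k))) (r-prime : Prime (suc (2 * (k + k)))) where

  open import Data.Bool using (Bool; true; false; T; _∧_; not; if_then_else_)
  import Data.Bool as Bool
  open import Data.Integer as ℤ using (ℤ; +_; -_)
  open import Data.Integer.DivMod using (_%ℕ_)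
  open import Data.Nat
  open import Data.Nat.DivMod
  open import Data.Nat.Divisibility using (m∣m*n; n∣m*n)
  open import Data.Nat.Properties
  open import Data.Nat.Tactic.RingSolver using (solve-∀)
  open import Data.Bool.Properties using (T-∧; T-≡; ∧-assoc; ∧-zeroʳ; ∧-identityʳ)
  open import Data.Nat.Coprimality using (Coprime; coprime?)
  open import Data.List using (filter; length; map; upTo)
  open import Data.Product using (_×_; _,_; proj₁; proj₂)
  open import Level using (0ℓ)
  open import Relation.Unary using (Pred; Decidable)
  open import Function using (_⇔_; mk⇔; Equivalence)
  open import Function.Construct.Composition using (_⇔-∘_)
  open import Relation.Binary.PropositionalEquality
  open import Relation.Nullary using (Dec; yes; no; contradiction)
  open import Relation.Nullary.Decidable using (⌊_⌋; _×-dec_; toWitness; fromWitness)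

  open import Defs
  open Counting
  open Jacobi

  q r n : ℕ
  q = suc (2 * k)
  r = suc (2 * (k + k))
  n = q * r

  module Q = QuadraticResidues k q-prime
  module R = QuadraticResidues (k + k) r-prime

  q<r : q < r
  q<r = s≤s (*-monoʳ-< 2 (m<m+n k Q.0<k))

  open TwoPrimes q-prime r-prime q<r

  1<n : 1 < n
  1<n = <-≤-trans Q.1<p (m≤m*n q r)

  e : ℕ
  e = k + (k + k) * q

  [n∸1]/2≡e : (n ∸ 1) / 2 ≡ e
  [n∸1]/2≡e = trans (cong (λ m → (m ∸ 1) / 2) (n≡1+e*2 k)) (m*n/n≡m e 2)
    where
    n≡1+e*2 : ∀ k → suc (2 * k) * suc (2 * (k + k)) ≡ suc ((k + (k + k) * suc (2 * k)) * 2)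
    n≡1+e*2 = solve-∀

  -- Defined by if_then_else_, as in legendre, so that legendre-unit holds by computation.
  sgn : Bool → ℤ
  sgn b = if b then + 1 else - (+ 1)

  sgn-* : ∀ b c → sgn b ℤ.* sgn c ≡ sgn ⌊ b Bool.≟ c ⌋
  sgn-* true true = refl
  sgn-* true false = refl
  sgn-* false true = refl
  sgn-* false false = refl

  legendre-unit : ∀ a m → 0 < a % suc m → legendre (+ a) (suc m) ≡ sgn (isSquareMod (a % suc m) (suc m))
  legendre-unit a m 0<a%m with a % suc m ≟ 0
  ... | yes a%m≡0 = contradiction a%m≡0 (>⇒≢ 0<a%m)
  ... | no _ = refl

  signₙ : Bool → ℕ
  signₙ true = 1
  signₙ false = n ∸ 1

  sgn%n : ∀ b → sgn b %ℕ n ≡ signₙ b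
  sgn%n true = m<n⇒m%n≡m 1<n
  sgn%n false = minus-one%n 1<n
    where
    minus-one%n : ∀ {m} .{{_ : NonZero m}} → 1 < m → - (+ 1) %ℕ m ≡ m ∸ 1
    minus-one%n {suc zero} (s≤s ())
    minus-one%n {suc (suc m)} _ = refl

  signₙ<n : ∀ b → signₙ b < n
  signₙ<n true = 1<n
  signₙ<n false = ∸-monoʳ-< z<s (<⇒≤ 1<n)

  signₙ≈signq : ∀ b → signₙ b Q.≈ Q.sign b
  signₙ≈signq true = Q.≈-refl
  signₙ≈signq false = Q.≈-trans (Q.≡⇒≈ (n∸1≡ k)) (Q.a+k*m≈a (2 * k) (2 * (k + k)))
    where
    n∸1≡ : ∀ k → suc (2 * k) * suc (2 * (k + k)) ∸ 1 ≡ 2 * k + 2 * (k + k) * suc (2 * k)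
    n∸1≡ k = cong (_∸ 1) (identity k)
      where
      identity : ∀ k → suc (2 * k) * suc (2 * (k + k)) ≡ suc (2 * k + 2 * (k + k) * suc (2 * k))
      identity = solve-∀

  signₙ≈signr : ∀ b → signₙ b R.≈ R.sign b
  signₙ≈signr true = R.≈-refl
  signₙ≈signr false = R.≈-trans (R.≡⇒≈ (n∸1≡ k)) (R.a+k*m≈a (2 * (k + k)) (2 * k))
    where
    n∸1≡ : ∀ k → suc (2 * k) * suc (2 * (k + k)) ∸ 1 ≡ 2 * (k + k) + 2 * k * suc (2 * (k + k))
    n∸1≡ k = cong (_∸ 1) (identity k)
      where
      identity : ∀ k → suc (2 * k) * suc (2 * (k + k)) ≡ suc (2 * (k + k) + 2 * k * suc (2 * (k + k)))
      identity = solve-∀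

  liarResidue : ℕ → ℕ → Bool
  liarResidue u v = R.isNonzeroSquare v ∧ ⌊ v ^ k R.≈? R.sign (isSquareMod u q) ⌋

  ≡⇔≈q×≈r : ∀ {x y} → x < n → y < n → x ≡ y ⇔ (x Q.≈ y × x R.≈ y)
  ≡⇔≈q×≈r x<n y<n = mk⇔ (λ { refl → Q.≈-refl , R.≈-refl })
                          (λ (x≈y[q] , x≈y[r]) → crt-injective x<n y<n (Q.%≡% x≈y[q]) (R.%≡% x≈y[r]))

  module Unit (a : ℕ) (0<u : 0 < a % q) (0<v : 0 < a % r) where

    u v : ℕ
    u = a % q
    v = a % r

    jacobi≡ : jacobi (+ a) n ≡ sgn ⌊ isSquareMod u q Bool.≟ isSquareMod v r ⌋
    jacobi≡ = begin
      jacobi (+ a) n                                    ≡⟨ jacobi-product (+ a) q-prime r-prime q<r ⟩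
      legendre (+ a) q ℤ.* legendre (+ a) r
        ≡⟨ cong₂ ℤ._*_ (legendre-unit a (2 * k) 0<u) (legendre-unit a (2 * (k + k)) 0<v) ⟩
      sgn (isSquareMod u q) ℤ.* sgn (isSquareMod v r)   ≡⟨ sgn-* (isSquareMod u q) (isSquareMod v r) ⟩
      sgn ⌊ isSquareMod u q Bool.≟ isSquareMod v r ⌋     ∎
      where open ≡-Reasoning

    power-mod-q : a ^ e % n Q.≈ Q.sign (isSquareMod u q)
    power-mod-q = begin
        a ^ e % n                       ≈⟨ Q.mod≡ (m∣n⇒o%n%m≡o%m q n (a ^ e) (m∣m*n r)) ⟩
        a ^ e                           ≈⟨ Q.^-congˡ e (Q.%-≈ a) ⟨
        u ^ e                           ≡⟨ cong (u ^_) (e≡k*[1+2q] k) ⟩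
        u ^ (k * suc (2 * q))           ≡⟨ ^-*-assoc u k (suc (2 * q)) ⟨
        (u ^ k) ^ suc (2 * q)           ≈⟨ Q.^-congˡ (suc (2 * q)) (Q.euler u (Q.0<<p⇒≉0 0<u (m%n<n a q))) ⟩
        Q.sign (isSquareMod u q) ^ suc (2 * q) ≈⟨ Q.^-odd q (Q.sign²≈1 (isSquareMod u q)) ⟩
        Q.sign (isSquareMod u q)        ∎
      where
      open Q.≈-Reasoning
      e≡k*[1+2q] : ∀ k → k + (k + k) * suc (2 * k) ≡ k * suc (2 * suc (2 * k))
      e≡k*[1+2q] = solve-∀

    power-mod-r : a ^ e % n R.≈ v ^ k * R.sign (isSquareMod v r)
    power-mod-r = begin
        a ^ e % n                       ≈⟨ R.mod≡ (m∣n⇒o%n%m≡o%m r n (a ^ e) (n∣m*n q)) ⟩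
        a ^ e                           ≈⟨ R.^-congˡ e (R.%-≈ a) ⟨
        v ^ e                           ≡⟨ ^-distribˡ-+-* v k ((k + k) * q) ⟩
        v ^ k * v ^ ((k + k) * q)       ≡⟨ cong (v ^ k *_) (^-*-assoc v (k + k) q) ⟨
        v ^ k * (v ^ (k + k)) ^ q       ≈⟨ R.*-congˡ (v ^ k) (R.^-congˡ q (R.euler v (R.0<<p⇒≉0 0<v (m%n<n a r)))) ⟩
        v ^ k * R.sign (isSquareMod v r) ^ q ≈⟨ R.*-congˡ (v ^ k) (R.^-odd k (R.sign²≈1 (isSquareMod v r))) ⟩
        v ^ k * R.sign (isSquareMod v r) ∎
      where open R.≈-Reasoning

    private
      jacobi-sign : Bool
      jacobi-sign = ⌊ isSquareMod u q Bool.≟ isSquareMod v r ⌋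

      power-test : Bool
      power-test = ⌊ v ^ k R.≈? R.sign (isSquareMod u q) ⌋

      residue⁺ : T (isSquareMod v r) → v ^ k R.≈ R.sign (isSquareMod u q) → T (liarResidue u v)
      residue⁺ square-v v^k≈sign = Equivalence.from (T-∧ {R.isNonzeroSquare v} {power-test})
        (Equivalence.from (T-∧ {0 <ᵇ v} {isSquareMod v r}) (<⇒<ᵇ 0<v , square-v) , fromWitness v^k≈sign)

      residue⁻ : T (liarResidue u v) → isSquareMod v r ≡ true × v ^ k R.≈ R.sign (isSquareMod u q)
      residue⁻ residue =
        let (nonzero-square , power) = Equivalence.to (T-∧ {R.isNonzeroSquare v} {power-test}) residue
        in Equivalence.to T-≡ (proj₂ (Equivalence.to (T-∧ {0 <ᵇ v} {isSquareMod v r}) nonzero-square))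
         , toWitness power

      jacobi-sign≡ : isSquareMod v r ≡ true → jacobi-sign ≡ isSquareMod u q
      jacobi-sign≡ square-v =
        trans (cong (λ b → ⌊ isSquareMod u q Bool.≟ b ⌋) square-v) (⌊≟true⌋ (isSquareMod u q))

      agree⇒true : ∀ b c → ⌊ b Bool.≟ c ⌋ ≡ b → c ≡ true
      agree⇒true false true _ = refl
      agree⇒true true true _ = refl

      v^k*sign≡v^k : isSquareMod v r ≡ true → v ^ k * R.sign (isSquareMod v r) ≡ v ^ k
      v^k*sign≡v^k square-v = trans (cong (λ b → v ^ k * R.sign b) square-v) (*-identityʳ (v ^ k))

      liar⇔signs : EulerLiar n a ⇔ (signₙ jacobi-sign Q.≈ a ^ e % n × signₙ jacobi-sign R.≈ a ^ e % n)
      liar⇔signs = ≡⇔≈q×≈r (signₙ<n jacobi-sign) (m%n<n (a ^ e) n) ⇔-∘ mk⇔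
        (λ liar → trans (sym jacobi%n) (trans liar exponent))
        (λ signs → trans jacobi%n (trans signs (sym exponent)))
        where
        jacobi%n : jacobi (+ a) n %ℕ n ≡ signₙ jacobi-sign
        jacobi%n = trans (cong (_%ℕ n) jacobi≡) (sgn%n jacobi-sign)
        exponent : a ^ ((n ∸ 1) / 2) % n ≡ a ^ e % n
        exponent = cong (λ m → a ^ m % n) [n∸1]/2≡e

    liar⇔ : EulerLiar n a ⇔ T (liarResidue u v)
    liar⇔ = mk⇔ to from ⇔-∘ liar⇔signs
      where
      to : signₙ jacobi-sign Q.≈ a ^ e % n × signₙ jacobi-sign R.≈ a ^ e % n → T (liarResidue u v)
      to (≈q , ≈r) = residue⁺ (Equivalence.from T-≡ square-v) v^k≈sign
        where
        sign≡ : jacobi-sign ≡ isSquareMod u q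
        sign≡ = Q.sign-injective (Q.≈-trans (Q.≈-sym (signₙ≈signq jacobi-sign)) (Q.≈-trans ≈q power-mod-q))
        square-v : isSquareMod v r ≡ true
        square-v = agree⇒true (isSquareMod u q) (isSquareMod v r) sign≡
        v^k≈sign : v ^ k R.≈ R.sign (isSquareMod u q)
        v^k≈sign = begin
          v ^ k                                 ≡⟨ v^k*sign≡v^k square-v ⟨
          v ^ k * R.sign (isSquareMod v r)      ≈⟨ power-mod-r ⟨
          a ^ e % n                             ≈⟨ ≈r ⟨
          signₙ jacobi-sign                     ≈⟨ signₙ≈signr jacobi-sign ⟩
          R.sign jacobi-sign                    ≡⟨ cong R.sign sign≡ ⟩
          R.sign (isSquareMod u q)              ∎
          where open R.≈-Reasoning
      from : T (liarResidue u v) → signₙ jacobi-sign Q.≈ a ^ e % n × signₙ jacobi-sign R.≈ a ^ e % n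
      from residue = ≈q , ≈r
        where
        square-v = proj₁ (residue⁻ residue)
        v^k≈sign = proj₂ (residue⁻ residue)
        sign≡ = jacobi-sign≡ square-v
        ≈q : signₙ jacobi-sign Q.≈ a ^ e % n
        ≈q = begin
          signₙ jacobi-sign                     ≈⟨ signₙ≈signq jacobi-sign ⟩
          Q.sign jacobi-sign                    ≡⟨ cong Q.sign sign≡ ⟩
          Q.sign (isSquareMod u q)              ≈⟨ power-mod-q ⟨
          a ^ e % n                             ∎
          where open Q.≈-Reasoning
        ≈r : signₙ jacobi-sign R.≈ a ^ e % n
        ≈r = begin
          signₙ jacobi-sign                     ≈⟨ signₙ≈signr jacobi-sign ⟩
          R.sign jacobi-sign                    ≡⟨ cong R.sign sign≡ ⟩
          R.sign (isSquareMod u q)              ≈⟨ v^k≈sign ⟨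
          v ^ k                                 ≡⟨ v^k*sign≡v^k square-v ⟨
          v ^ k * R.sign (isSquareMod v r)      ≈⟨ power-mod-r ⟨
          a ^ e % n                             ∎
          where open R.≈-Reasoning

    jacobi-of-liar : T (liarResidue u v) → jacobi (+ a) n ≡ sgn (isSquareMod u q)
    jacobi-of-liar residue = trans jacobi≡ (cong sgn (jacobi-sign≡ (proj₁ (residue⁻ residue))))

  isUnit isLiar : ℕ → Bool
  isUnit a = ⌊ coprime? a n ⌋
  isLiar a = ⌊ eulerLiar? n a ⌋

  hasJacobi : ℤ → ℕ → Bool
  hasJacobi s a = ⌊ jacobi (+ a) n ℤ.≟ s ⌋

  hasLegendre : ℤ → ℕ → Bool
  hasLegendre s u = (0 <ᵇ u) ∧ ⌊ sgn (isSquareMod u q) ℤ.≟ s ⌋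

  private
    ∧-cong-T : ∀ x {y z} → (T x → y ≡ z) → x ∧ y ≡ x ∧ z
    ∧-cong-T false _ = refl
    ∧-cong-T true y≡z = y≡z _

    ∧-absorb : ∀ x {y z} → x ∧ ((x ∧ y) ∧ z) ≡ (x ∧ y) ∧ z
    ∧-absorb false = refl
    ∧-absorb true = refl

    ∧-exchange : ∀ x y {z w} → (T x → T y → z ≡ w) → (x ∧ y) ∧ z ≡ (x ∧ w) ∧ y
    ∧-exchange false _ _ = refl
    ∧-exchange true false {w = w} _ = sym (∧-zeroʳ w)
    ∧-exchange true true {w = w} z≡w = trans (z≡w _ _) (sym (∧-identityʳ w))

  unit∧liar≡ : ∀ a → isUnit a ∧ isLiar a ≡ (0 <ᵇ a % q) ∧ liarResidue (a % q) (a % r)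
  unit∧liar≡ a = begin
      isUnit a ∧ isLiar a                               ≡⟨ cong (_∧ isLiar a) (isUnit≡ a) ⟩
      ((0 <ᵇ u) ∧ (0 <ᵇ v)) ∧ isLiar a                  ≡⟨ ∧-assoc (0 <ᵇ u) (0 <ᵇ v) (isLiar a) ⟩
      (0 <ᵇ u) ∧ ((0 <ᵇ v) ∧ isLiar a)
        ≡⟨ ∧-cong-T (0 <ᵇ u) (λ 0<ᵇu → ∧-cong-T (0 <ᵇ v) (λ 0<ᵇv →
             ⌊⌋-reflects (Unit.liar⇔ a (<ᵇ⇒< 0 u 0<ᵇu) (<ᵇ⇒< 0 v 0<ᵇv)) (eulerLiar? n a))) ⟩
      (0 <ᵇ u) ∧ ((0 <ᵇ v) ∧ liarResidue u v)           ≡⟨ cong ((0 <ᵇ u) ∧_) (∧-absorb (0 <ᵇ v)) ⟩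
      (0 <ᵇ u) ∧ liarResidue u v                        ∎
    where
    open ≡-Reasoning
    u = a % q
    v = a % r

  unit∧liar∧jacobi≡ : ∀ a s →
    (isUnit a ∧ isLiar a) ∧ hasJacobi s a ≡ hasLegendre s (a % q) ∧ liarResidue (a % q) (a % r)
  unit∧liar∧jacobi≡ a s = trans (cong (_∧ hasJacobi s a) (unit∧liar≡ a))
    (∧-exchange (0 <ᵇ u) (liarResidue u v) (λ 0<ᵇu residue →
      cong (λ j → ⌊ j ℤ.≟ s ⌋) (Unit.jacobi-of-liar a (<ᵇ⇒< 0 u 0<ᵇu) (<ᵇ⇒< 0 v (0<ᵇv residue)) residue)))
    where
    u = a % q
    v = a % r
    0<ᵇv : T (liarResidue u v) → T (0 <ᵇ v)
    0<ᵇv residue = proj₁ (Equivalence.to T-∧ (proj₁ (Equivalence.to (T-∧ {R.isNonzeroSquare v}) residue)))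

  count-units : count isUnit n ≡ 2 * k * (2 * (k + k))
  count-units = begin
      count isUnit n                                        ≡⟨ count-cong n (λ a _ → isUnit≡ a) ⟩
      count (λ a → (0 <ᵇ a % q) ∧ (0 <ᵇ a % r)) n
        ≡⟨ count-crt (λ u v → (0 <ᵇ u) ∧ (0 <ᵇ v)) (0 <ᵇ_) (2 * (k + k)) rows ⟩
      count (0 <ᵇ_) q * (2 * (k + k))                       ≡⟨ cong (_* (2 * (k + k))) (count-positive (2 * k)) ⟩
      2 * k * (2 * (k + k))                                 ∎
    where
    open ≡-Reasoning
    rows : ∀ u → u < q → count (λ v → (0 <ᵇ u) ∧ (0 <ᵇ v)) r ≡ toℕ (0 <ᵇ u) * (2 * (k + k))
    rows u _ = trans (count-const-∧ (0 <ᵇ u) (0 <ᵇ_) r) (cong (toℕ (0 <ᵇ u) *_) (count-positive (2 * (k + k))))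

  count-liars-by-residue : ∀ (g : ℕ → Bool) →
    count (λ a → g (a % q) ∧ liarResidue (a % q) (a % r)) n ≡ count g q * k
  count-liars-by-residue g = count-crt (λ u v → g u ∧ liarResidue u v) g k rows
    where
    open R.OneModFour k refl using (count-quartic)
    rows : ∀ u → u < q → count (λ v → g u ∧ liarResidue u v) r ≡ toℕ (g u) * k
    rows u _ = trans (count-const-∧ (g u) (liarResidue u) r) (cong (toℕ (g u) *_) (count-quartic (isSquareMod u q)))

  count-liars : count (λ a → isUnit a ∧ isLiar a) n ≡ 2 * k * k
  count-liars = begin
      count (λ a → isUnit a ∧ isLiar a) n                                ≡⟨ count-cong n (λ a _ → unit∧liar≡ a) ⟩
      count (λ a → (0 <ᵇ a % q) ∧ liarResidue (a % q) (a % r)) n         ≡⟨ count-liars-by-residue (0 <ᵇ_) ⟩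
      count (0 <ᵇ_) q * k                                                ≡⟨ cong (_* k) (count-positive (2 * k)) ⟩
      2 * k * k                                                          ∎
    where open ≡-Reasoning

  count-liars-with-jacobi : ∀ s →
    count (λ a → (isUnit a ∧ isLiar a) ∧ hasJacobi s a) n ≡ count (hasLegendre s) q * k
  count-liars-with-jacobi s = trans (count-cong n (λ a _ → unit∧liar∧jacobi≡ a s))
                                    (count-liars-by-residue (hasLegendre s))

  count-legendre+1 : count (hasLegendre (+ 1)) q ≡ k
  count-legendre+1 = trans (count-cong q (λ u _ → cong ((0 <ᵇ u) ∧_) (⌊sgn≟+1⌋ (isSquareMod u q))))
                           Q.count-nonzero-squares≡k
    where
    ⌊sgn≟+1⌋ : ∀ b → ⌊ sgn b ℤ.≟ + 1 ⌋ ≡ b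
    ⌊sgn≟+1⌋ true = refl
    ⌊sgn≟+1⌋ false = refl

  count-legendre-1 : count (hasLegendre (- (+ 1))) q ≡ k
  count-legendre-1 = +-cancelˡ-≡ k _ _ (begin
      k + count (hasLegendre (- (+ 1))) q
        ≡⟨ cong₂ _+_ (sym Q.count-nonzero-squares≡k)
                     (count-cong q (λ u _ → cong ((0 <ᵇ u) ∧_) (⌊sgn≟-1⌋ (isSquareMod u q)))) ⟩
      count Q.isNonzeroSquare q + count (λ u → (0 <ᵇ u) ∧ not (isSquareMod u q)) q
        ≡⟨ count-∧ (0 <ᵇ_) (λ u → isSquareMod u q) q ⟨
      count (0 <ᵇ_) q                                       ≡⟨ count-positive (2 * k) ⟩
      2 * k                                                 ≡⟨ cong (λ x → k + x) (+-identityʳ k) ⟩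
      k + k                                                 ∎)
    where
    open ≡-Reasoning
    ⌊sgn≟-1⌋ : ∀ b → ⌊ sgn b ℤ.≟ - (+ 1) ⌋ ≡ not b
    ⌊sgn≟-1⌋ true = refl
    ⌊sgn≟-1⌋ false = refl

  private
    non-unit : ∀ {a} → a % q ≡ 0 → isUnit a ≡ false
    non-unit {a} a%q≡0 = trans (isUnit≡ a) (cong (λ x → (0 <ᵇ x) ∧ (0 <ᵇ a % r)) a%q≡0)

    length-filter-below-n : ∀ {P : Pred ℕ 0ℓ} (P? : Decidable P) → ⌊ P? 0 ⌋ ≡ false →
      length (filter P? (map suc (upTo (n ∸ 1)))) ≡ count (λ a → ⌊ P? a ⌋) n
    length-filter-below-n P? P0≡false =
      trans (length-filter-map-suc P? (n ∸ 1)) (count-from-1 (λ a → ⌊ P? a ⌋) (n ∸ 1) P0≡false)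

  φ≡ : φ n ≡ 2 * k * (2 * (k + k))
  φ≡ = begin
      φ n                                 ≡⟨ length-filter-map-suc (λ a → coprime? a n) n ⟩
      count (λ a → isUnit (suc a)) n      ≡⟨ count-from-1 isUnit n (non-unit {0} refl) ⟩
      count isUnit n + toℕ (isUnit n)     ≡⟨ cong (λ b → count isUnit n + toℕ b) (non-unit n%q≡0) ⟩
      count isUnit n + 0                  ≡⟨ +-identityʳ _ ⟩
      count isUnit n                      ≡⟨ count-units ⟩
      2 * k * (2 * (k + k))               ∎
    where
    open ≡-Reasoning
    n%q≡0 : n % q ≡ 0
    n%q≡0 = trans (cong (_% q) (*-comm q r)) (m*n%n≡0 r q)

  length-eulerLiars : length (eulerLiars n) ≡ 2 * k * k
  length-eulerLiars = begin
      length (eulerLiars n)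
        ≡⟨ cong length (filter-filter (eulerLiar? n) (λ a → coprime? a n) (map suc (upTo (n ∸ 1)))) ⟩
      length (filter (λ a → coprime? a n ×-dec eulerLiar? n a) (map suc (upTo (n ∸ 1))))
        ≡⟨ length-filter-below-n (λ a → coprime? a n ×-dec eulerLiar? n a)
             (trans (⌊×-dec⌋ (coprime? 0 n) (eulerLiar? n 0)) (cong (_∧ isLiar 0) (non-unit {0} refl))) ⟩
      count (λ a → ⌊ coprime? a n ×-dec eulerLiar? n a ⌋) n
        ≡⟨ count-cong n (λ a _ → ⌊×-dec⌋ (coprime? a n) (eulerLiar? n a)) ⟩
      count (λ a → isUnit a ∧ isLiar a) n                   ≡⟨ count-liars ⟩
      2 * k * k                                             ∎
    where open ≡-Reasoning

  liarsWithJacobi≡ : ∀ s → liarsWithJacobi n s ≡ count (hasLegendre s) q * k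
  liarsWithJacobi≡ s = begin
      liarsWithJacobi n s
        ≡⟨ cong length (filter-filter J? (eulerLiar? n) (filter (λ a → coprime? a n) xs)) ⟩
      length (filter (λ a → eulerLiar? n a ×-dec J? a) (filter (λ a → coprime? a n) xs))
        ≡⟨ cong length (filter-filter (λ a → eulerLiar? n a ×-dec J? a) (λ a → coprime? a n) xs) ⟩
      length (filter UL∧J? xs)
        ≡⟨ length-filter-below-n UL∧J?
             (trans (⌊×-dec⌋ (coprime? 0 n) _) (cong (_∧ ⌊ eulerLiar? n 0 ×-dec J? 0 ⌋) (non-unit {0} refl))) ⟩
      count (λ a → ⌊ UL∧J? a ⌋) n                           ≡⟨ count-cong n (λ a _ → split a) ⟩
      count (λ a → (isUnit a ∧ isLiar a) ∧ hasJacobi s a) n ≡⟨ count-liars-with-jacobi s ⟩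
      count (hasLegendre s) q * k                           ∎
    where
    open ≡-Reasoning
    xs = map suc (upTo (n ∸ 1))
    J? : ∀ a → Dec (jacobi (+ a) n ≡ s)
    J? a = jacobi (+ a) n ℤ.≟ s
    UL∧J? : ∀ a → Dec (Coprime a n × (EulerLiar n a × jacobi (+ a) n ≡ s))
    UL∧J? a = coprime? a n ×-dec (eulerLiar? n a ×-dec J? a)
    split : ∀ a → ⌊ UL∧J? a ⌋ ≡ (isUnit a ∧ isLiar a) ∧ hasJacobi s a
    split a = begin
      ⌊ UL∧J? a ⌋                                 ≡⟨ ⌊×-dec⌋ (coprime? a n) _ ⟩
      isUnit a ∧ ⌊ eulerLiar? n a ×-dec J? a ⌋     ≡⟨ cong (isUnit a ∧_) (⌊×-dec⌋ (eulerLiar? n a) (J? a)) ⟩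
      isUnit a ∧ (isLiar a ∧ hasJacobi s a)       ≡⟨ ∧-assoc (isUnit a) _ _ ⟨
      (isUnit a ∧ isLiar a) ∧ hasJacobi s a       ∎

  euler-liar-counts : (length (eulerLiars n) ≡ φ n / 4) × (liarsWithJacobi n (+ 1) ≡ liarsWithJacobi n (- (+ 1)))
  euler-liar-counts = trans length-eulerLiars (sym φ/4≡)
                    , trans (liarsWithJacobi≡ (+ 1)) (trans (cong (_* k) (trans count-legendre+1 (sym count-legendre-1)))
                                                            (sym (liarsWithJacobi≡ (- (+ 1)))))
    where
    φ/4≡ : φ n / 4 ≡ 2 * k * k
    φ/4≡ = trans (cong (_/ 4) (trans φ≡ (identity k))) (m*n/n≡m (2 * k * k) 4)
      where
      identity : ∀ k → 2 * k * (2 * (k + k)) ≡ 2 * k * k * 4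
      identity = solve-∀

open import Data.Nat using (_∸_; _/_)
open import Data.Nat.Divisibility using (divides)
open import Data.Nat.Primality using (prime⇒irreducible)
open import Data.Nat.Properties using (*-suc; *-comm; <⇒≤; <⇒≢)
open import Data.Nat.Tactic.RingSolver using (solve-∀)
open import Data.Integer using (+_; -_)
open import Data.List using (length)
open import Data.Product using (_×_; _,_; ∃-syntax)
open import Data.Sum using (_⊎_; inj₁; inj₂)
open import Relation.Binary.PropositionalEquality
open import Relation.Nullary using (contradiction)

open import Defs

even-or-odd : ∀ m → (∃[ j ] m ≡ 2 * j) ⊎ (∃[ j ] m ≡ suc (2 * j))
even-or-odd 0 = inj₁ (0 , refl)
even-or-odd 1 = inj₂ (0 , refl)
even-or-odd (suc (suc m)) with even-or-odd m
... | inj₁ (j , refl) = inj₁ (suc j , sym (*-suc 2 j))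
... | inj₂ (j , refl) = inj₂ (suc j , cong suc (sym (*-suc 2 j)))

odd-prime : ∀ {p} → Prime p → 2 < p → ∃[ k ] p ≡ suc (2 * k)
odd-prime {p} p-prime 2<p with even-or-odd p
... | inj₂ odd = odd
... | inj₁ (j , p≡2j) with prime⇒irreducible p-prime (divides j (trans p≡2j (*-comm 2 j)))
...   | inj₂ 2≡p = contradiction 2≡p (<⇒≢ 2<p)

2[1+2k]∸1≡1+2[k+k] : ∀ k → 2 * suc (2 * k) ∸ 1 ≡ suc (2 * (k + k))
2[1+2k]∸1≡1+2[k+k] k = cong (_∸ 1) (identity k)
  where
  identity : ∀ k → 2 * suc (2 * k) ≡ suc (suc (2 * (k + k)))
  identity = solve-∀

mainTheorem7 : (p₁ p₂ : ℕ) → Prime p₁ → 3 < p₁ → p₂ ≡ 2 * p₁ ∸ 1 → Prime p₂ →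
    (n : ℕ) → .{{_ : NonZero n}} → n ≡ p₁ * p₂ →
    (length (eulerLiars n) ≡ φ n / 4)
    × (liarsWithJacobi n (+ 1) ≡ liarsWithJacobi n (- (+ 1)))
mainTheorem7 p₁ p₂ p₁-prime 3<p₁ p₂≡2p₁∸1 p₂-prime n n≡p₁p₂ with odd-prime p₁-prime (<⇒≤ 3<p₁)
... | k , refl with trans p₂≡2p₁∸1 (2[1+2k]∸1≡1+2[k+k] k) | n≡p₁p₂
...   | refl | refl = Liars.euler-liar-counts k p₁-prime p₂-prime
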